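{- Let $G$ be a connected finite simple graph with $|V(G)|\ge 3$. Then $\det'(G)=\det(L(G))$ if and only if $G$ is not isomorphic to any of $G_1,G_2,G_3$, where $G_1$ has vertex set $\{1,2,3,4\}$ and edges $\{1,2\},\{2,3\},\{2,4\},\{3,4\}$; $G_2$ has vertex set $\{1,2,3,4\}$ and edges $\{1,2\},\{2,3\},\{3,4\},\{1,3\},\{2,4\}$; and $G_3=K_4$.
   Context: An automorphism of $G$ is a permutation of $V(G)$ preserving adjacency. A vertex set $S$ is a vertex determining set if the only automorphism fixing every vertex of $S$ is the identity; $\det(G)$ is the minimum size of such a set. For a graph with at most one isolated vertex and no $K_2$ component, an edge set $T$ is an edge determining set if the only automorphism $\phi$ with $\{\phi(u),\phi(v)\}=\{u,v\}$ for all $\{u,v\}\in T$ is the identity; $\det'(G)$ is the minimum size of such a set. $L(G)$ denotes the line graph of $G$. -}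

module Defs where

open import Data.Nat using (ℕ; _≤_; _≥_)
open import Data.Bool using (Bool; true; false)
open import Data.Fin using (Fin; _<_) renaming (zero to f0; suc to fs)
open import Data.Product using (Σ; _×_; _,_; proj₁; proj₂; ∃)
open import Data.Sum using (_⊎_)
open import Data.List using (List; length)
open import Data.List.Membership.Propositional using (_∈_)
open import Data.List.Relation.Unary.Unique.Propositional using (Unique)
open import Relation.Binary.PropositionalEquality using (_≡_; _≢_)
open import Function.Bundles using (_↔_; Inverse; _⇔_)

record SimpleGraph (n : ℕ) : Set where
  field
    adj   : Fin n → Fin n → Bool
    sym   : ∀ u v → adj u v ≡ adj v u
    irrfl : ∀ v → adj v v ≡ false

open SimpleGraph public

Adj : ∀ {n} → SimpleGraph n → Fin n → Fin n → Set
Adj G u v = adj G u v ≡ true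

data Reach {n} (G : SimpleGraph n) : Fin n → Fin n → Set where
  here : ∀ {v} → Reach G v v
  step : ∀ {u v w} → Adj G u v → Reach G v w → Reach G u w

Connected : ∀ {n} → SimpleGraph n → Set
Connected G = ∀ u v → Reach G u v

Iso : ∀ {n m} → SimpleGraph n → SimpleGraph m → Set
Iso {n} {m} G H =
  Σ (Fin n ↔ Fin m) λ f →
    ∀ u v → adj H (Inverse.to f u) (Inverse.to f v) ≡ adj G u v

-- General graphs (adjacency relation on an arbitrary vertex type);
-- used for line graphs, whose vertices are the edges of G.

record Graph (V : Set) : Set₁ where
  field
    Rel : V → V → Set

open Graph public

Aut : ∀ {V} → Graph V → Set
Aut {V} Γ = Σ (V ↔ V) λ f → ∀ u v → (Rel Γ (Inverse.to f u) (Inverse.to f v) ⇔ Rel Γ u v)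

IsIdentity : ∀ {V} {Γ : Graph V} → Aut Γ → Set
IsIdentity {V} φ = ∀ (v : V) → Inverse.to (proj₁ φ) v ≡ v

-- vertex sets are represented by duplicate-free lists; |S| = length
VertexDetSet : ∀ {V} (Γ : Graph V) → List V → Set
VertexDetSet Γ S =
  ∀ (φ : Aut Γ) → (∀ v → v ∈ S → Inverse.to (proj₁ φ) v ≡ v) → IsIdentity φ

DetIs : ∀ {V} (Γ : Graph V) → ℕ → Set
DetIs {V} Γ k =
  (Σ (List V) λ S → Unique S × length S ≡ k × VertexDetSet Γ S) ×
  (∀ S → Unique S → VertexDetSet Γ S → k ≤ length S)

toGraph : ∀ {n} → SimpleGraph n → Graph (Fin n)
toGraph G = record { Rel = Adj G }

-- an edge {u,v} is represented uniquely as (u , v) with u < v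
Edge : ∀ {n} → SimpleGraph n → Set
Edge {n} G = Σ (Fin n × Fin n) λ p → (proj₁ p < proj₂ p) × Adj G (proj₁ p) (proj₂ p)

endL endR : ∀ {n} {G : SimpleGraph n} → Edge G → Fin n
endL e = proj₁ (proj₁ e)
endR e = proj₂ (proj₁ e)

Incident : ∀ {n} {G : SimpleGraph n} → Fin n → Edge G → Set
Incident {G = G} v e = v ≡ endL {G = G} e ⊎ v ≡ endR {G = G} e

L : ∀ {n} → (G : SimpleGraph n) → Graph (Edge G)
L {n} G = record
  { Rel = λ e f → e ≢ f × Σ (Fin n) λ v → Incident {G = G} v e × Incident {G = G} v f }

EdgeDetSet : ∀ {n} (G : SimpleGraph n) → List (Edge G) → Set
EdgeDetSet G T =
  ∀ (φ : Aut (toGraph G)) →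
    (∀ e → e ∈ T →
       let f = Inverse.to (proj₁ φ)
           x = endL {G = G} e
           y = endR {G = G} e in
       (f x ≡ x × f y ≡ y) ⊎ (f x ≡ y × f y ≡ x)) →
    IsIdentity φ

EdgeDetIs : ∀ {n} (G : SimpleGraph n) → ℕ → Set
EdgeDetIs G k =
  (Σ (List (Edge G)) λ T → Unique T × length T ≡ k × EdgeDetSet G T) ×
  (∀ T → Unique T → EdgeDetSet G T → k ≤ length T)

-- The exceptional graphs, on {1,2,3,4} ↦ Fin 4 = {0,1,2,3}

private
  eqF : ∀ {n} → Fin n → Fin n → Bool
  eqF f0 f0 = true
  eqF f0 (fs _) = false
  eqF (fs _) f0 = false
  eqF (fs a) (fs b) = eqF a b

adj₁ : Fin 4 → Fin 4 → Bool
adj₁ f0 (fs f0) = true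
adj₁ (fs f0) f0 = true
adj₁ (fs f0) (fs (fs f0)) = true
adj₁ (fs (fs f0)) (fs f0) = true
adj₁ (fs f0) (fs (fs (fs f0))) = true
adj₁ (fs (fs (fs f0))) (fs f0) = true
adj₁ (fs (fs f0)) (fs (fs (fs f0))) = true
adj₁ (fs (fs (fs f0))) (fs (fs f0)) = true
adj₁ _ _ = false

adj₂ : Fin 4 → Fin 4 → Bool
adj₂ f0 (fs f0) = true
adj₂ (fs f0) f0 = true
adj₂ (fs f0) (fs (fs f0)) = true
adj₂ (fs (fs f0)) (fs f0) = true
adj₂ (fs (fs f0)) (fs (fs (fs f0))) = true
adj₂ (fs (fs (fs f0))) (fs (fs f0)) = true
adj₂ f0 (fs (fs f0)) = true
adj₂ (fs (fs f0)) f0 = true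
adj₂ (fs f0) (fs (fs (fs f0))) = true
adj₂ (fs (fs (fs f0))) (fs f0) = true
adj₂ _ _ = false

adj₃ : Fin 4 → Fin 4 → Bool
adj₃ u v = Data.Bool.not (eqF u v)

private
  allFin4 : (P : Fin 4 → Set) → P f0 → P (fs f0) → P (fs (fs f0)) → P (fs (fs (fs f0))) → ∀ v → P v
  allFin4 P a b c d f0 = a
  allFin4 P a b c d (fs f0) = b
  allFin4 P a b c d (fs (fs f0)) = c
  allFin4 P a b c d (fs (fs (fs f0))) = d

  open import Relation.Binary.PropositionalEquality using (refl)

  sym₁ : ∀ u v → adj₁ u v ≡ adj₁ v u
  sym₁ = allFin4 _ (allFin4 _ refl refl refl refl) (allFin4 _ refl refl refl refl)
                   (allFin4 _ refl refl refl refl) (allFin4 _ refl refl refl refl)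
  sym₂ : ∀ u v → adj₂ u v ≡ adj₂ v u
  sym₂ = allFin4 _ (allFin4 _ refl refl refl refl) (allFin4 _ refl refl refl refl)
                   (allFin4 _ refl refl refl refl) (allFin4 _ refl refl refl refl)
  sym₃ : ∀ u v → adj₃ u v ≡ adj₃ v u
  sym₃ = allFin4 _ (allFin4 _ refl refl refl refl) (allFin4 _ refl refl refl refl)
                   (allFin4 _ refl refl refl refl) (allFin4 _ refl refl refl refl)

G₁ G₂ G₃ : SimpleGraph 4
G₁ = record { adj = adj₁ ; sym = sym₁ ; irrfl = allFin4 _ refl refl refl refl }
G₂ = record { adj = adj₂ ; sym = sym₂ ; irrfl = allFin4 _ refl refl refl refl }
G₃ = record { adj = adj₃ ; sym = sym₃ ; irrfl = allFin4 _ refl refl refl refl }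

module Submission where

-- An automorphism φ of G fixing every edge of T setwise induces an automorphism of L(G) fixing T
-- pointwise, and a bijection stabilising every edge of a connected graph on at least three vertices
-- is the identity; hence det′(G) ≤ det(L(G)). Conversely every automorphism ψ of L(G) maps the star
-- of each vertex v into the star of a vertex w, unless it maps a claw onto a triangle, which forces v
-- to have degree three and G to consist of v and its neighbours, i.e. G ≅ G₁, G₂ or G₃. Otherwise
-- v ↦ w is an automorphism of G inducing ψ, and det(L(G)) ≤ det′(G). For the three exceptional
-- graphs, edge determining sets of sizes 1, 1, 2 are found by enumerating all maps Fin 4 → Fin 4,
-- while L(Gᵢ) has 2, 2, 3 disjoint pairs of twin vertices, each of which a determining set must meet.

open import Defs
open import Axiom.UniquenessOfIdentityProofs using (module Decidable⇒UIP)
open import Data.Bool using (true; false)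
import Data.Bool.Properties as Bool
open import Data.Empty using (⊥; ⊥-elim)
open import Data.Fin using (Fin; _<_) renaming (zero to f0; suc to fs)
import Data.Fin.Properties as Fin
open import Data.Nat as ℕ using (ℕ; s≤s; _≥_)
import Data.Nat.Properties as ℕ
open import Data.Product using (Σ; Σ-syntax; _×_; _,_; proj₁; proj₂)
import Data.Product as Product
open import Data.Sum using (_⊎_; inj₁; inj₂; [_,_]′)
import Data.Sum as Sum
open import Data.List using (List; []; _∷_; length; map; lookup)
open import Data.List.Membership.Propositional using (_∈_)
open import Data.List.Membership.Propositional.Properties using (∈-map⁺)
open import Data.List.Properties using (length-map)
open import Data.List.Relation.Unary.Unique.Propositional using (Unique)
open import Data.List.Relation.Unary.All using (All; []; _∷_)
open import Data.List.Relation.Unary.AllPairs using ([]; _∷_)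
import Data.List.Relation.Unary.All as All
import Data.List.Relation.Unary.Unique.Propositional.Properties as Unique
import Data.List.Relation.Unary.Any as Any
open import Data.List.Relation.Unary.Any.Properties using (lookup-index)
import Data.List.Membership.DecPropositional as DecMembership
open import Function using (_∘_; id)
open import Function.Bundles using (_↔_; Inverse; Injection; _⇔_; mk⇔; mk↔ₛ′)
open import Function.Properties.Inverse using (↔-sym; ↔-trans; Inverse⇒Injection)
open import Function.Construct.Identity using (⇔-id)
open import Function.Construct.Symmetry using (⇔-sym)
open import Function.Construct.Composition using () renaming (equivalence to ⇔-trans)
open import Relation.Binary using (tri<; tri≈; tri>)
open import Relation.Binary.PropositionalEquality
  using (_≡_; _≢_; _≗_; refl; trans; cong; cong₂; subst; subst₂; ≢-sym)
  renaming (sym to ≡-sym)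
open import Relation.Nullary using (¬_; Dec; yes; no)
open import Relation.Nullary.Decidable using (_×-dec_; _⊎-dec_; _→-dec_; ¬?; True; toWitness)

open Inverse using (to; from; strictlyInverseˡ; strictlyInverseʳ)
open Function.Bundles.Equivalence using () renaming (to to ⇔-to; from to ⇔-from)

↔-injective : ∀ {A B : Set} (f : A ↔ B) {x y : A} → to f x ≡ to f y → x ≡ y
↔-injective f = Injection.injective (Inverse⇒Injection f)

infix 4 _≅_

_≅_ : ∀ {V W} → Graph V → Graph W → Set
_≅_ {V} {W} Γ Δ = Σ (V ↔ W) λ f → ∀ u v → Rel Δ (to f u) (to f v) ⇔ Rel Γ u v

module _ {U V W : Set} {Γ : Graph U} {Δ : Graph V} {Θ : Graph W} where

  ≅-trans : Γ ≅ Δ → Δ ≅ Θ → Γ ≅ Θ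
  ≅-trans (f , f-hom) (g , g-hom) = ↔-trans f g , λ u v →
    mk⇔ (λ r → ⇔-to (f-hom u v) (⇔-to (g-hom (to f u) (to f v)) r))
        (λ r → ⇔-from (g-hom (to f u) (to f v)) (⇔-from (f-hom u v) r))

≅-sym : ∀ {V W} {Γ : Graph V} {Δ : Graph W} → Γ ≅ Δ → Δ ≅ Γ
≅-sym {Δ = Δ} (f , f-hom) = ↔-sym f , λ u v →
  mk⇔ (λ r → subst₂ (Rel Δ) (strictlyInverseˡ f u) (strictlyInverseˡ f v)
                (⇔-from (f-hom (from f u) (from f v)) r))
      (λ r → ⇔-to (f-hom (from f u) (from f v))
                (subst₂ (Rel Δ) (≡-sym (strictlyInverseˡ f u)) (≡-sym (strictlyInverseˡ f v)) r))

conjugate : ∀ {V W} {Γ : Graph V} {Δ : Graph W} → Γ ≅ Δ → Aut Δ → Aut Γ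
conjugate {Γ = Γ} {Δ} f ψ =
  ≅-trans {Δ = Δ} {Θ = Γ} (≅-trans {Δ = Δ} {Θ = Δ} f ψ) (≅-sym {Γ = Γ} {Δ = Δ} f)

Iso⇒≅ : ∀ {n m} {G : SimpleGraph n} {H : SimpleGraph m} → Iso G H → toGraph G ≅ toGraph H
Iso⇒≅ (f , f-adj) = f , λ u v → mk⇔ (trans (≡-sym (f-adj u v))) (trans (f-adj u v))

module Edges {n : ℕ} (G : SimpleGraph n) where

  infix 4 _∈ₑ_ _∈ₑ?_ _≟ₑ_

  _∈ₑ_ : Fin n → Edge G → Set
  v ∈ₑ e = Incident {G = G} v e

  lo hi : Edge G → Fin n
  lo = endL {G = G}
  hi = endR {G = G}

  adj-sym : ∀ {a b} → Adj G a b → Adj G b a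
  adj-sym {a} {b} = trans (SimpleGraph.sym G b a)

  adj⇒≢ : ∀ {a b} → Adj G a b → a ≢ b
  adj⇒≢ {a} p refl with trans (≡-sym p) (irrfl G a)
  ... | ()

  adj? : ∀ a b → Dec (Adj G a b)
  adj? a b = adj G a b Bool.≟ true

  edge-≡ : (e f : Edge G) → lo e ≡ lo f → hi e ≡ hi f → e ≡ f
  edge-≡ ((a , b) , a<b , ab) ((.a , .b) , a<b′ , ab′) refl refl
    rewrite Fin.<-irrelevant a<b a<b′ | Decidable⇒UIP.≡-irrelevant Bool._≟_ ab ab′ = refl

  _≟ₑ_ : (e f : Edge G) → Dec (e ≡ f)
  e ≟ₑ f with lo e Fin.≟ lo f | hi e Fin.≟ hi f
  ... | yes p | yes q = yes (edge-≡ e f p q)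
  ... | no p  | _     = no λ e≡f → p (cong lo e≡f)
  ... | _     | no q  = no λ e≡f → q (cong hi e≡f)

  _∈ₑ?_ : ∀ v e → Dec (v ∈ₑ e)
  v ∈ₑ? e = (v Fin.≟ lo e) ⊎-dec (v Fin.≟ hi e)

  lo≢hi : (e : Edge G) → lo e ≢ hi e
  lo≢hi (_ , lo<hi , _) eq = Fin.<-irrefl eq lo<hi

  edge-adj : (e : Edge G) → Adj G (lo e) (hi e)
  edge-adj (_ , _ , ab) = ab

  edge-of : ∀ {a b} → Adj G a b → Σ[ e ∈ Edge G ] a ∈ₑ e × b ∈ₑ e
  edge-of {a} {b} ab with Fin.<-cmp a b
  ... | tri< a<b _ _ = ((a , b) , a<b , ab) , inj₁ refl , inj₂ refl
  ... | tri≈ _ a≡b _ = ⊥-elim (adj⇒≢ ab a≡b)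
  ... | tri> _ _ b<a = ((b , a) , b<a , adj-sym ab) , inj₂ refl , inj₁ refl

  ends⇒adj : ∀ {a b} (e : Edge G) → a ≢ b → a ∈ₑ e → b ∈ₑ e → Adj G a b
  ends⇒adj e a≢b (inj₁ refl) (inj₁ refl) = ⊥-elim (a≢b refl)
  ends⇒adj e a≢b (inj₂ refl) (inj₂ refl) = ⊥-elim (a≢b refl)
  ends⇒adj e a≢b (inj₁ refl) (inj₂ refl) = edge-adj e
  ends⇒adj e a≢b (inj₂ refl) (inj₁ refl) = adj-sym (edge-adj e)

  ends-unique : ∀ {a b x} (e : Edge G) → a ≢ b → a ∈ₑ e → b ∈ₑ e → x ∈ₑ e → x ≡ a ⊎ x ≡ b
  ends-unique e a≢b (inj₁ refl) (inj₁ refl) _ = ⊥-elim (a≢b refl)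
  ends-unique e a≢b (inj₂ refl) (inj₂ refl) _ = ⊥-elim (a≢b refl)
  ends-unique e a≢b (inj₁ refl) (inj₂ refl) x∈e = x∈e
  ends-unique e a≢b (inj₂ refl) (inj₁ refl) (inj₁ p) = inj₂ p
  ends-unique e a≢b (inj₂ refl) (inj₁ refl) (inj₂ p) = inj₁ p

  ends⇒≡ : ∀ {a b} (e f : Edge G) → a ≢ b → a ∈ₑ e → b ∈ₑ e → a ∈ₑ f → b ∈ₑ f → e ≡ f
  ends⇒≡ e f a≢b (inj₁ refl) (inj₁ refl) _ _ = ⊥-elim (a≢b refl)
  ends⇒≡ e f a≢b (inj₂ refl) (inj₂ refl) _ _ = ⊥-elim (a≢b refl)
  ends⇒≡ e f a≢b _ _ (inj₁ refl) (inj₁ refl) = ⊥-elim (a≢b refl)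
  ends⇒≡ e f a≢b _ _ (inj₂ refl) (inj₂ refl) = ⊥-elim (a≢b refl)
  ends⇒≡ e f a≢b (inj₁ refl) (inj₂ refl) (inj₁ p) (inj₂ q) = edge-≡ e f p q
  ends⇒≡ e f a≢b (inj₂ refl) (inj₁ refl) (inj₂ p) (inj₁ q) = edge-≡ e f q p
  ends⇒≡ e f a≢b (inj₁ refl) (inj₂ refl) (inj₂ p) (inj₁ q) =
    ⊥-elim (Fin.<-asym (proj₁ (proj₂ e)) (subst₂ _<_ (≡-sym q) (≡-sym p) (proj₁ (proj₂ f))))
  ends⇒≡ e f a≢b (inj₂ refl) (inj₁ refl) (inj₁ p) (inj₂ q) =
    ⊥-elim (Fin.<-asym (proj₁ (proj₂ e)) (subst₂ _<_ (≡-sym p) (≡-sym q) (proj₁ (proj₂ f))))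

  common-end-unique : ∀ {e f c d} → e ≢ f → c ∈ₑ e → c ∈ₑ f → d ∈ₑ e → d ∈ₑ f → d ≡ c
  common-end-unique {e} {f} {c} {d} e≢f c∈e c∈f d∈e d∈f with d Fin.≟ c
  ... | yes d≡c = d≡c
  ... | no d≢c = ⊥-elim (e≢f (ends⇒≡ e f d≢c d∈e c∈e d∈f c∈f))

  record OtherEnd (v : Fin n) (e : Edge G) : Set where
    field
      end      : Fin n
      end≢v    : end ≢ v
      end∈e    : end ∈ₑ e
      v-or-end : ∀ x → x ∈ₑ e → x ≡ v ⊎ x ≡ end

  other-end : ∀ {v} (e : Edge G) → v ∈ₑ e → OtherEnd v e
  other-end e (inj₁ refl) = record
    { end = hi e ; end≢v = ≢-sym (lo≢hi e) ; end∈e = inj₂ refl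
    ; v-or-end = λ _ → ends-unique e (lo≢hi e) (inj₁ refl) (inj₂ refl) }
  other-end e (inj₂ refl) = record
    { end = lo e ; end≢v = lo≢hi e ; end∈e = inj₁ refl
    ; v-or-end = λ _ → ends-unique e (≢-sym (lo≢hi e)) (inj₂ refl) (inj₁ refl) }

  infix 4 _~_

  _~_ : Edge G → Edge G → Set
  _~_ = Rel (L G)

  ~-sym : ∀ {e f} → e ~ f → f ~ e
  ~-sym (e≢f , v , v∈e , v∈f) = ≢-sym e≢f , v , v∈f , v∈e

  ~-comm : ∀ {e f} → e ~ f ⇔ f ~ e
  ~-comm = mk⇔ ~-sym ~-sym

  ~-irrefl : ∀ {e} → ¬ e ~ e
  ~-irrefl (e≢e , _) = e≢e refl

module EdgeMap {n m : ℕ} (G : SimpleGraph n) (H : SimpleGraph m) where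
  private
    module G = Edges G
    module H = Edges H

    image : (f : toGraph G ≅ toGraph H) (e : Edge G) →
            Σ[ e′ ∈ Edge H ] to (proj₁ f) (G.lo e) H.∈ₑ e′ × to (proj₁ f) (G.hi e) H.∈ₑ e′
    image (f , f-adj) e = H.edge-of (⇔-from (f-adj (G.lo e) (G.hi e)) (G.edge-adj e))

  mapEdge : toGraph G ≅ toGraph H → Edge G → Edge H
  mapEdge f e = proj₁ (image f e)

  mapEdge-∈ : (f : toGraph G ≅ toGraph H) → ∀ {v} e → v G.∈ₑ e → to (proj₁ f) v H.∈ₑ mapEdge f e
  mapEdge-∈ f e (inj₁ refl) = proj₁ (proj₂ (image f e))
  mapEdge-∈ f e (inj₂ refl) = proj₂ (proj₂ (image f e))

  mapEdge-∈⁻ : (f : toGraph G ≅ toGraph H) → ∀ {w} e → w H.∈ₑ mapEdge f e → from (proj₁ f) w G.∈ₑ e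
  mapEdge-∈⁻ f e w∈fe
    with H.ends-unique (mapEdge f e) (λ eq → G.lo≢hi e (↔-injective (proj₁ f) eq))
           (mapEdge-∈ f e (inj₁ refl)) (mapEdge-∈ f e (inj₂ refl)) w∈fe
  ... | inj₁ refl = inj₁ (strictlyInverseʳ (proj₁ f) (G.lo e))
  ... | inj₂ refl = inj₂ (strictlyInverseʳ (proj₁ f) (G.hi e))

lineGraph-≅ : ∀ {n m} (G : SimpleGraph n) (H : SimpleGraph m) → toGraph G ≅ toGraph H → L G ≅ L H
lineGraph-≅ G H f = mk↔ₛ′ (mapEdge f) (mapEdge⁻ f⁻¹) f∘f⁻¹ f⁻¹∘f , λ e e′ → mk⇔
  (λ (fe≢fe′ , w , w∈fe , w∈fe′) →
     (λ e≡e′ → fe≢fe′ (cong (mapEdge f) e≡e′)) , from F w , mapEdge-∈⁻ f e w∈fe , mapEdge-∈⁻ f e′ w∈fe′)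
  (λ (e≢e′ , v , v∈e , v∈e′) →
     (λ fe≡fe′ → e≢e′ (trans (≡-sym (f⁻¹∘f e)) (trans (cong (mapEdge⁻ f⁻¹) fe≡fe′) (f⁻¹∘f e′))))
     , to F v , mapEdge-∈ f e v∈e , mapEdge-∈ f e′ v∈e′)
  where
    module G = Edges G
    module H = Edges H
    open EdgeMap G H
    open EdgeMap H G using () renaming (mapEdge to mapEdge⁻; mapEdge-∈ to mapEdge⁻-∈)
    F = proj₁ f
    f⁻¹ = ≅-sym {Γ = toGraph G} {Δ = toGraph H} f

    f⁻¹∘f : ∀ e → mapEdge⁻ f⁻¹ (mapEdge f e) ≡ e
    f⁻¹∘f e = ≡-sym (G.ends⇒≡ e e′ (G.lo≢hi e) (inj₁ refl) (inj₂ refl)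
      (subst (G._∈ₑ e′) (strictlyInverseʳ F (G.lo e)) (mapEdge⁻-∈ f⁻¹ (mapEdge f e) (mapEdge-∈ f e (inj₁ refl))))
      (subst (G._∈ₑ e′) (strictlyInverseʳ F (G.hi e)) (mapEdge⁻-∈ f⁻¹ (mapEdge f e) (mapEdge-∈ f e (inj₂ refl)))))
      where e′ = mapEdge⁻ f⁻¹ (mapEdge f e)

    f∘f⁻¹ : ∀ e → mapEdge f (mapEdge⁻ f⁻¹ e) ≡ e
    f∘f⁻¹ e = ≡-sym (H.ends⇒≡ e e′ (H.lo≢hi e) (inj₁ refl) (inj₂ refl)
      (subst (H._∈ₑ e′) (strictlyInverseˡ F (H.lo e)) (mapEdge-∈ f (mapEdge⁻ f⁻¹ e) (mapEdge⁻-∈ f⁻¹ e (inj₁ refl))))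
      (subst (H._∈ₑ e′) (strictlyInverseˡ F (H.hi e)) (mapEdge-∈ f (mapEdge⁻ f⁻¹ e) (mapEdge⁻-∈ f⁻¹ e (inj₂ refl)))))
      where e′ = mapEdge f (mapEdge⁻ f⁻¹ e)

one-of-three-avoids : ∀ {n} (a b c u v : Fin n) → a ≢ b → a ≢ c → b ≢ c → Σ[ z ∈ Fin n ] z ≢ u × z ≢ v
one-of-three-avoids a b c u v a≢b a≢c b≢c with a Fin.≟ u | a Fin.≟ v
... | no a≢u | no a≢v = a , a≢u , a≢v
... | yes refl | _ with b Fin.≟ v
...   | no b≢v = b , ≢-sym a≢b , b≢v
...   | yes refl = c , ≢-sym a≢c , ≢-sym b≢c
one-of-three-avoids a b c u v a≢b a≢c b≢c | no _ | yes refl with b Fin.≟ u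
...   | no b≢u = b , b≢u , ≢-sym a≢b
...   | yes refl = c , ≢-sym b≢c , ≢-sym a≢c

vertex-avoiding : ∀ {n} → n ≥ 3 → (u v : Fin n) → Σ[ z ∈ Fin n ] z ≢ u × z ≢ v
vertex-avoiding (s≤s (s≤s (s≤s _))) u v =
  one-of-three-avoids f0 (fs f0) (fs (fs f0)) u v (λ ()) (λ ()) (λ ())

module ConnectedGraph {n : ℕ} (G : SimpleGraph n) (conn : Connected G) (n≥3 : n ≥ 3) where
  open Edges G

  leave-pair : ∀ {u v w z} → (w ≡ u ⊎ w ≡ v) → z ≢ u → z ≢ v → Reach G w z →
               Σ[ x ∈ Fin n ] Σ[ y ∈ Fin n ] (x ≡ u ⊎ x ≡ v) × y ≢ u × y ≢ v × Adj G x y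
  leave-pair (inj₁ refl) z≢u z≢v here = ⊥-elim (z≢u refl)
  leave-pair (inj₂ refl) z≢u z≢v here = ⊥-elim (z≢v refl)
  leave-pair {u} {v} {w} w∈uv z≢u z≢v (step {v = y} wy y⇝z) with y Fin.≟ u | y Fin.≟ v
  ... | yes y≡u | _        = leave-pair (inj₁ y≡u) z≢u z≢v y⇝z
  ... | no _    | yes y≡v  = leave-pair (inj₂ y≡v) z≢u z≢v y⇝z
  ... | no y≢u  | no y≢v   = w , y , w∈uv , y≢u , y≢v , wy

  has-neighbour : ∀ v → Σ[ y ∈ Fin n ] Adj G v y
  has-neighbour v with vertex-avoiding n≥3 v v
  ... | z , z≢v , _ with conn v z
  ...   | here = ⊥-elim (z≢v refl)
  ...   | step {v = y} vy _ = y , vy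

  neighbour-of-pendant-branches : ∀ {u v} → (∀ y → Adj G v y → y ≡ u) → Σ[ y ∈ Fin n ] Adj G u y × y ≢ v
  neighbour-of-pendant-branches {u} {v} leaf with vertex-avoiding n≥3 u v
  ... | z , z≢u , z≢v with leave-pair (inj₁ refl) z≢u z≢v (conn u z)
  ...   | _ , y , inj₁ refl , y≢u , y≢v , uy = y , uy , y≢v
  ...   | _ , y , inj₂ refl , y≢u , y≢v , vy = ⊥-elim (y≢u (leaf y vy))

  same-star⇒≡ : ∀ {w w′} → (∀ f → w ∈ₑ f → w′ ∈ₑ f) → (∀ f → w′ ∈ₑ f → w ∈ₑ f) → w ≡ w′
  same-star⇒≡ {w} {w′} w⊆w′ w′⊆w with w Fin.≟ w′
  ... | yes w≡w′ = w≡w′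
  ... | no w≢w′ with vertex-avoiding n≥3 w w′
  ...   | z , z≢w , z≢w′ with leave-pair (inj₁ refl) z≢w z≢w′ (conn w z)
  ...     | x , y , x∈ww′ , y≢w , y≢w′ , xy with edge-of xy
  ...       | g , x∈g , y∈g = ⊥-elim ([ y≢w , y≢w′ ]′ (ends-unique g w≢w′ w∈g w′∈g y∈g))
    where
      w∈g : w ∈ₑ g
      w∈g = [ (λ { refl → x∈g }) , (λ { refl → w′⊆w g x∈g }) ]′ x∈ww′
      w′∈g : w′ ∈ₑ g
      w′∈g = [ (λ { refl → w⊆w′ g x∈g }) , (λ { refl → x∈g }) ]′ x∈ww′

  data LocalShape (v : Fin n) : Set where
    branching : ∀ {y y′} → Adj G v y → Adj G v y′ → y′ ≢ y → LocalShape v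
    pendant   : ∀ {y y′} → Adj G v y → (∀ z → Adj G v z → z ≡ y) →
                Adj G y y′ → y′ ≢ v → LocalShape v

  local-shape : ∀ v → LocalShape v
  local-shape v with has-neighbour v
  ... | y , vy with Fin.any? (λ y′ → adj? v y′ ×-dec ¬? (y′ Fin.≟ y))
  ...   | yes (y′ , vy′ , y′≢y) = branching vy vy′ y′≢y
  ...   | no no-other = pendant vy only-y yy′ y′≢v
    where
      only-y : ∀ z → Adj G v z → z ≡ y
      only-y z vz with z Fin.≟ y
      ... | yes z≡y = z≡y
      ... | no z≢y = ⊥-elim (no-other (z , vz , z≢y))
      y-branches = neighbour-of-pendant-branches only-y
      y′ = proj₁ y-branches
      yy′ = proj₁ (proj₂ y-branches)
      y′≢v = proj₂ (proj₂ y-branches)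

-- det′(G) ≤ det(L(G))

module Stabiliser {n : ℕ} (G : SimpleGraph n) where
  open Edges G

  Stabilises : (Fin n ↔ Fin n) → Edge G → Set
  Stabilises φ e = ∀ v → v ∈ₑ e → to φ v ∈ₑ e

  FixesEnds : (Fin n → Fin n) → Edge G → Set
  FixesEnds t e = (t (lo e) ≡ lo e × t (hi e) ≡ hi e) ⊎ (t (lo e) ≡ hi e × t (hi e) ≡ lo e)

  fixesEnds? : ∀ t e → Dec (FixesEnds t e)
  fixesEnds? t e = (t (lo e) Fin.≟ lo e ×-dec t (hi e) Fin.≟ hi e)
             ⊎-dec (t (lo e) Fin.≟ hi e ×-dec t (hi e) Fin.≟ lo e)

  fixesEnds-cong : ∀ {s t} → s ≗ t → ∀ e → FixesEnds s e → FixesEnds t e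
  fixesEnds-cong s≗t e = Sum.map (Product.map (trans (≡-sym (s≗t (lo e)))) (trans (≡-sym (s≗t (hi e)))))
                                 (Product.map (trans (≡-sym (s≗t (lo e)))) (trans (≡-sym (s≗t (hi e)))))

  fixesEnds⇒stabilises : ∀ φ e → FixesEnds (to φ) e → Stabilises φ e
  fixesEnds⇒stabilises φ e (inj₁ (p , q)) v (inj₁ refl) = inj₁ p
  fixesEnds⇒stabilises φ e (inj₁ (p , q)) v (inj₂ refl) = inj₂ q
  fixesEnds⇒stabilises φ e (inj₂ (p , q)) v (inj₁ refl) = inj₂ p
  fixesEnds⇒stabilises φ e (inj₂ (p , q)) v (inj₂ refl) = inj₁ q

  stabilises⇒fixesEnds : ∀ φ e → Stabilises φ e → FixesEnds (to φ) e
  stabilises⇒fixesEnds φ e stab with stab (lo e) (inj₁ refl) | stab (hi e) (inj₂ refl)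
  ... | inj₁ p | inj₁ q = ⊥-elim (lo≢hi e (↔-injective φ (trans p (≡-sym q))))
  ... | inj₁ p | inj₂ q = inj₁ (p , q)
  ... | inj₂ p | inj₁ q = inj₂ (p , q)
  ... | inj₂ p | inj₂ q = ⊥-elim (lo≢hi e (↔-injective φ (trans p (≡-sym q))))

module _ {n : ℕ} (G : SimpleGraph n) (conn : Connected G) (n≥3 : n ≥ 3) where
  open Edges G
  open ConnectedGraph G conn n≥3
  open Stabiliser G

  module _ (φ : Fin n ↔ Fin n) (stab : ∀ e → Stabilises φ e) where
    private
      fixed-or-swapped : ∀ {x y} → Adj G x y → to φ x ≡ x ⊎ to φ x ≡ y
      fixed-or-swapped xy with edge-of xy
      ... | e , x∈e , y∈e = ends-unique e (adj⇒≢ xy) x∈e y∈e (stab e _ x∈e)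

      fixed-by-two-neighbours : ∀ {x y y′} → Adj G x y → Adj G x y′ → y′ ≢ y → to φ x ≡ x
      fixed-by-two-neighbours xy xy′ y′≢y with fixed-or-swapped xy | fixed-or-swapped xy′
      ... | inj₁ fixed | _          = fixed
      ... | inj₂ _     | inj₁ fixed = fixed
      ... | inj₂ x↦y   | inj₂ x↦y′  = ⊥-elim (y′≢y (trans (≡-sym x↦y′) x↦y))

    stabilising-all-edges⇒identity : ∀ v → to φ v ≡ v
    stabilising-all-edges⇒identity v with local-shape v
    ... | branching vy vy′ y′≢y = fixed-by-two-neighbours vy vy′ y′≢y
    ... | pendant vy _ yy′ y′≢v with fixed-or-swapped vy
    ...   | inj₁ fixed = fixed
    ...   | inj₂ v↦y = ⊥-elim (adj⇒≢ vy (↔-injective φ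
              (trans v↦y (≡-sym (fixed-by-two-neighbours (adj-sym vy) yy′ y′≢v)))))

  vertexDet⇒edgeDet : ∀ S → VertexDetSet (L G) S → EdgeDetSet G S
  vertexDet⇒edgeDet S S-det φ φ-fixes-S = stabilising-all-edges⇒identity (proj₁ φ) stabilises
    where
      open EdgeMap G G
      induced-fixes-S : ∀ e → e ∈ S → mapEdge φ e ≡ e
      induced-fixes-S e e∈S = ≡-sym (ends⇒≡ e (mapEdge φ e) (λ eq → lo≢hi e (↔-injective (proj₁ φ) eq))
        (fixesEnds⇒stabilises (proj₁ φ) e (φ-fixes-S e e∈S) (lo e) (inj₁ refl))
        (fixesEnds⇒stabilises (proj₁ φ) e (φ-fixes-S e e∈S) (hi e) (inj₂ refl))
        (mapEdge-∈ φ e (inj₁ refl)) (mapEdge-∈ φ e (inj₂ refl)))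
      stabilises : ∀ e → Stabilises (proj₁ φ) e
      stabilises e v v∈e =
        subst (to (proj₁ φ) v ∈ₑ_) (S-det (lineGraph-≅ G G φ) induced-fixes-S e) (mapEdge-∈ φ e v∈e)

  edgeDet≤det : ∀ a b → EdgeDetIs G a → DetIs (L G) b → a ℕ.≤ b
  edgeDet≤det a b (_ , a-min) ((S , S-unique , |S|≡b , S-det) , _) =
    subst (a ℕ.≤_) |S|≡b (a-min S S-unique (vertexDet⇒edgeDet S S-det))

module Triangles {n : ℕ} (G : SimpleGraph n) where
  open Edges G

  CommonEnd : Edge G → Edge G → Edge G → Set
  CommonEnd f₁ f₂ f₃ = Σ[ w ∈ Fin n ] w ∈ₑ f₁ × w ∈ₑ f₂ × w ∈ₑ f₃

  Triangle : Edge G → Edge G → Edge G → Set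
  Triangle f₁ f₂ f₃ = f₁ ~ f₂ × f₁ ~ f₃ × f₂ ~ f₃ × ¬ CommonEnd f₁ f₂ f₃

  triangle-¬one-neighbour : ∀ {f₁ f₂ f₃ h} → Triangle f₁ f₂ f₃ → h ~ f₁ → ¬ h ~ f₂ → ¬ h ~ f₃ → ⊥
  triangle-¬one-neighbour {f₁} {f₂} {f₃} {h} (f₁~f₂ , f₁~f₃ , f₂~f₃ , no-common) (_ , p , p∈h , p∈f₁) h≁f₂ h≁f₃ =
    through-other-end f₁~f₂ f₁~f₃ (other-end f₁ p∈f₁)
    where
      p∉ : ∀ {f g} → f ~ g → ¬ h ~ f → ¬ h ~ g → ¬ p ∈ₑ f
      p∉ {f} f~g h≁f h≁g p∈f with h ≟ₑ f
      ... | yes refl = h≁g f~g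
      ... | no h≢f = h≁f (h≢f , p , p∈h , p∈f)
      through-other-end : f₁ ~ f₂ → f₁ ~ f₃ → OtherEnd p f₁ → ⊥
      through-other-end (_ , c , c∈f₁ , c∈f₂) (_ , d , d∈f₁ , d∈f₃) o
        with OtherEnd.v-or-end o c c∈f₁ | OtherEnd.v-or-end o d d∈f₁
      ... | inj₁ refl | _ = p∉ f₂~f₃ h≁f₂ h≁f₃ c∈f₂
      ... | _ | inj₁ refl = p∉ (~-sym f₂~f₃) h≁f₃ h≁f₂ d∈f₃
      ... | inj₂ refl | inj₂ refl = no-common (c , c∈f₁ , c∈f₂ , d∈f₃)

  triangle-rotate : ∀ {f₁ f₂ f₃} → Triangle f₁ f₂ f₃ → Triangle f₂ f₃ f₁
  triangle-rotate (f₁~f₂ , f₁~f₃ , f₂~f₃ , no-common) =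
    f₂~f₃ , ~-sym f₁~f₂ , ~-sym f₁~f₃ , λ (w , w∈₂ , w∈₃ , w∈₁) → no-common (w , w∈₁ , w∈₂ , w∈₃)

  triangle-swap : ∀ {f₁ f₂ f₃} → Triangle f₁ f₂ f₃ → Triangle f₁ f₃ f₂
  triangle-swap (f₁~f₂ , f₁~f₃ , f₂~f₃ , no-common) =
    f₁~f₃ , f₁~f₂ , ~-sym f₂~f₃ , λ (w , w∈₁ , w∈₃ , w∈₂) → no-common (w , w∈₁ , w∈₂ , w∈₃)

  -- The corners of the triangle are fᵢ ∩ fₖ, fⱼ ∩ fₖ and p; an edge joining p to a point q of fₖ
  -- therefore joins two corners and is one of the sides fᵢ, fⱼ.
  through-corner : ∀ {fᵢ fⱼ fₖ h p q} → Triangle fᵢ fⱼ fₖ → p ∈ₑ fᵢ → p ∈ₑ fⱼ → q ∈ₑ fₖ →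
                   p ∈ₑ h → q ∈ₑ h → p ≢ q → h ≢ fᵢ → h ≢ fⱼ → ⊥
  through-corner {fᵢ} {fⱼ} {fₖ} {h} (_ , (_ , a , a∈fᵢ , a∈fₖ) , (_ , b , b∈fⱼ , b∈fₖ) , no-common)
                 p∈fᵢ p∈fⱼ q∈fₖ p∈h q∈h p≢q h≢fᵢ h≢fⱼ with a Fin.≟ b
  ... | yes refl = no-common (a , a∈fᵢ , b∈fⱼ , a∈fₖ)
  ... | no a≢b with ends-unique fₖ a≢b a∈fₖ b∈fₖ q∈fₖ
  ...   | inj₁ refl = h≢fᵢ (ends⇒≡ h fᵢ p≢q p∈h q∈h p∈fᵢ a∈fᵢ)
  ...   | inj₂ refl = h≢fⱼ (ends⇒≡ h fⱼ p≢q p∈h q∈h p∈fⱼ b∈fⱼ)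

  triangle-¬three-neighbours : ∀ {f₁ f₂ f₃ h} → Triangle f₁ f₂ f₃ → h ~ f₁ → h ~ f₂ → h ~ f₃ → ⊥
  triangle-¬three-neighbours {f₁} {f₂} {f₃} {h} tri
    (h≢f₁ , c₁ , c₁∈h , c₁∈f₁) (h≢f₂ , c₂ , c₂∈h , c₂∈f₂) (h≢f₃ , c₃ , c₃∈h , c₃∈f₃) = go c₁∈h c₂∈h c₃∈h
    where
      lo≢hi′ = lo≢hi h
      hi≢lo′ = ≢-sym (lo≢hi h)
      go : c₁ ∈ₑ h → c₂ ∈ₑ h → c₃ ∈ₑ h → ⊥
      go (inj₁ refl) (inj₁ refl) (inj₁ refl) = proj₂ (proj₂ (proj₂ tri)) (c₁ , c₁∈f₁ , c₂∈f₂ , c₃∈f₃)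
      go (inj₂ refl) (inj₂ refl) (inj₂ refl) = proj₂ (proj₂ (proj₂ tri)) (c₁ , c₁∈f₁ , c₂∈f₂ , c₃∈f₃)
      go (inj₁ refl) (inj₁ refl) (inj₂ refl) =
        through-corner tri c₁∈f₁ c₂∈f₂ c₃∈f₃ (inj₁ refl) (inj₂ refl) lo≢hi′ h≢f₁ h≢f₂
      go (inj₂ refl) (inj₂ refl) (inj₁ refl) =
        through-corner tri c₁∈f₁ c₂∈f₂ c₃∈f₃ (inj₂ refl) (inj₁ refl) hi≢lo′ h≢f₁ h≢f₂
      go (inj₁ refl) (inj₂ refl) (inj₁ refl) =
        through-corner (triangle-swap tri) c₁∈f₁ c₃∈f₃ c₂∈f₂ (inj₁ refl) (inj₂ refl) lo≢hi′ h≢f₁ h≢f₃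
      go (inj₂ refl) (inj₁ refl) (inj₂ refl) =
        through-corner (triangle-swap tri) c₁∈f₁ c₃∈f₃ c₂∈f₂ (inj₂ refl) (inj₁ refl) hi≢lo′ h≢f₁ h≢f₃
      go (inj₂ refl) (inj₁ refl) (inj₁ refl) =
        through-corner (triangle-rotate tri) c₂∈f₂ c₃∈f₃ c₁∈f₁ (inj₁ refl) (inj₂ refl) lo≢hi′ h≢f₂ h≢f₃
      go (inj₁ refl) (inj₂ refl) (inj₂ refl) =
        through-corner (triangle-rotate tri) c₂∈f₂ c₃∈f₃ c₁∈f₁ (inj₂ refl) (inj₁ refl) hi≢lo′ h≢f₂ h≢f₃

Exceptional : ∀ {n} → SimpleGraph n → Set
Exceptional G = Iso G G₁ ⊎ Iso G G₂ ⊎ Iso G G₃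

pattern #0 = f0
pattern #1 = fs f0
pattern #2 = fs (fs f0)
pattern #3 = fs (fs (fs f0))

quadruple : ∀ {A : Set} → A → A → A → A → Fin 4 → A
quadruple a b c d #0 = a
quadruple a b c d #1 = b
quadruple a b c d #2 = c
quadruple a b c d #3 = d

quadruple-injective : ∀ {A : Set} {a b c d : A} → a ≢ b → a ≢ c → a ≢ d → b ≢ c → b ≢ d → c ≢ d →
                      ∀ i j → quadruple a b c d i ≡ quadruple a b c d j → i ≡ j
quadruple-injective ab ac ad bc bd cd = λ where
  #0 #0 _ → refl ; #0 #1 e → ⊥-elim (ab e) ; #0 #2 e → ⊥-elim (ac e) ; #0 #3 e → ⊥-elim (ad e)
  #1 #0 e → ⊥-elim (ab (≡-sym e)) ; #1 #1 _ → refl ; #1 #2 e → ⊥-elim (bc e) ; #1 #3 e → ⊥-elim (bd e)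
  #2 #0 e → ⊥-elim (ac (≡-sym e)) ; #2 #1 e → ⊥-elim (bc (≡-sym e)) ; #2 #2 _ → refl ; #2 #3 e → ⊥-elim (cd e)
  #3 #0 e → ⊥-elim (ad (≡-sym e)) ; #3 #1 e → ⊥-elim (bd (≡-sym e)) ; #3 #2 e → ⊥-elim (cd (≡-sym e)) ; #3 #3 _ → refl

module _ {n : ℕ} (G : SimpleGraph n) (X : SimpleGraph 4) (σ : Fin 4 → Fin n) where

  adj-table : adj G (σ #0) (σ #1) ≡ adj X #0 #1 → adj G (σ #0) (σ #2) ≡ adj X #0 #2 →
              adj G (σ #0) (σ #3) ≡ adj X #0 #3 → adj G (σ #1) (σ #2) ≡ adj X #1 #2 →
              adj G (σ #1) (σ #3) ≡ adj X #1 #3 → adj G (σ #2) (σ #3) ≡ adj X #2 #3 →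
              ∀ i j → adj G (σ i) (σ j) ≡ adj X i j
  adj-table p01 p02 p03 p12 p13 p23 i j = entry i j
    where
      flip : ∀ {i j} → adj G (σ i) (σ j) ≡ adj X i j → adj G (σ j) (σ i) ≡ adj X j i
      flip {i} {j} p = trans (SimpleGraph.sym G (σ j) (σ i)) (trans p (SimpleGraph.sym X i j))
      diag : ∀ i → adj G (σ i) (σ i) ≡ adj X i i
      diag i = trans (irrfl G (σ i)) (≡-sym (irrfl X i))
      entry : ∀ i j → adj G (σ i) (σ j) ≡ adj X i j
      entry = λ where
        #0 #0 → diag #0 ; #0 #1 → p01 ; #0 #2 → p02 ; #0 #3 → p03
        #1 #0 → flip p01 ; #1 #1 → diag #1 ; #1 #2 → p12 ; #1 #3 → p13
        #2 #0 → flip p02 ; #2 #1 → flip p12 ; #2 #2 → diag #2 ; #2 #3 → p23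
        #3 #0 → flip p03 ; #3 #1 → flip p13 ; #3 #2 → flip p23 ; #3 #3 → diag #3

  iso-from-Fin4 : (∀ i j → σ i ≡ σ j → i ≡ j) → (∀ x → Σ[ i ∈ Fin 4 ] σ i ≡ x) →
                  (∀ i j → adj G (σ i) (σ j) ≡ adj X i j) → Iso G X
  iso-from-Fin4 σ-inj σ-surj σ-adj = mk↔ₛ′ σ⁻¹ σ σ⁻¹∘σ σ∘σ⁻¹ , λ u v →
    trans (≡-sym (σ-adj (σ⁻¹ u) (σ⁻¹ v))) (cong₂ (adj G) (σ∘σ⁻¹ u) (σ∘σ⁻¹ v))
    where
      σ⁻¹ : Fin n → Fin 4
      σ⁻¹ x = proj₁ (σ-surj x)
      σ∘σ⁻¹ : ∀ x → σ (σ⁻¹ x) ≡ x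
      σ∘σ⁻¹ x = proj₂ (σ-surj x)
      σ⁻¹∘σ : ∀ i → σ⁻¹ (σ i) ≡ i
      σ⁻¹∘σ i = σ-inj _ _ (σ∘σ⁻¹ (σ i))

-- The number of edges among l₁ l₂ l₃ (1, 2 or 3) decides between G₁, G₂ and G₃; σ lists
-- the vertices of G in the order of the model graph.
module _ {n : ℕ} (G : SimpleGraph n) (v l₁ l₂ l₃ : Fin n)
  (v≢l₁ : v ≢ l₁) (v≢l₂ : v ≢ l₂) (v≢l₃ : v ≢ l₃) (l₁≢l₂ : l₁ ≢ l₂) (l₁≢l₃ : l₁ ≢ l₃) (l₂≢l₃ : l₂ ≢ l₃)
  (covers : ∀ x → x ≡ v ⊎ x ≡ l₁ ⊎ x ≡ l₂ ⊎ x ≡ l₃)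
  (v~l₁ : Adj G v l₁) (v~l₂ : Adj G v l₂) (v~l₃ : Adj G v l₃) where

  private
    flip : ∀ {x y b} → adj G x y ≡ b → adj G y x ≡ b
    flip {x} {y} = trans (SimpleGraph.sym G y x)

    onto : (σ : Fin 4 → Fin n) (iv i₁ i₂ i₃ : Fin 4) → σ iv ≡ v → σ i₁ ≡ l₁ → σ i₂ ≡ l₂ → σ i₃ ≡ l₃ →
           ∀ x → Σ[ i ∈ Fin 4 ] σ i ≡ x
    onto σ iv i₁ i₂ i₃ pv p₁ p₂ p₃ x with covers x
    ... | inj₁ refl = iv , pv
    ... | inj₂ (inj₁ refl) = i₁ , p₁
    ... | inj₂ (inj₂ (inj₁ refl)) = i₂ , p₂
    ... | inj₂ (inj₂ (inj₂ refl)) = i₃ , p₃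

  claw-with-chord⇒exceptional : Adj G l₁ l₂ ⊎ Adj G l₁ l₃ ⊎ Adj G l₂ l₃ → Exceptional G
  claw-with-chord⇒exceptional chord with adj G l₁ l₂ in a₁₂ | adj G l₁ l₃ in a₁₃ | adj G l₂ l₃ in a₂₃
  ... | false | false | false with chord
  ...   | inj₁ ()
  ...   | inj₂ (inj₁ ())
  ...   | inj₂ (inj₂ ())
  claw-with-chord⇒exceptional chord | true | false | false = inj₁
    (iso-from-Fin4 G G₁ σ (quadruple-injective (≢-sym v≢l₃) (≢-sym l₁≢l₃) (≢-sym l₂≢l₃) v≢l₁ v≢l₂ l₁≢l₂)
      (onto σ #1 #2 #3 #0 refl refl refl refl) (adj-table G G₁ σ (flip v~l₃) (flip a₁₃) (flip a₂₃) v~l₁ v~l₂ a₁₂))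
    where σ = quadruple l₃ v l₁ l₂
  claw-with-chord⇒exceptional chord | false | true | false = inj₁
    (iso-from-Fin4 G G₁ σ (quadruple-injective (≢-sym v≢l₂) (≢-sym l₁≢l₂) l₂≢l₃ v≢l₁ v≢l₃ l₁≢l₃)
      (onto σ #1 #2 #0 #3 refl refl refl refl) (adj-table G G₁ σ (flip v~l₂) (flip a₁₂) a₂₃ v~l₁ v~l₃ a₁₃))
    where σ = quadruple l₂ v l₁ l₃
  claw-with-chord⇒exceptional chord | false | false | true = inj₁
    (iso-from-Fin4 G G₁ σ (quadruple-injective (≢-sym v≢l₁) l₁≢l₂ l₁≢l₃ v≢l₂ v≢l₃ l₂≢l₃)
      (onto σ #1 #0 #2 #3 refl refl refl refl) (adj-table G G₁ σ (flip v~l₁) a₁₂ a₁₃ v~l₂ v~l₃ a₂₃))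
    where σ = quadruple l₁ v l₂ l₃
  claw-with-chord⇒exceptional chord | true | true | false = inj₂ (inj₁
    (iso-from-Fin4 G G₂ σ (quadruple-injective (≢-sym v≢l₂) (≢-sym l₁≢l₂) l₂≢l₃ v≢l₁ v≢l₃ l₁≢l₃)
      (onto σ #1 #2 #0 #3 refl refl refl refl) (adj-table G G₂ σ (flip v~l₂) (flip a₁₂) a₂₃ v~l₁ v~l₃ a₁₃)))
    where σ = quadruple l₂ v l₁ l₃
  claw-with-chord⇒exceptional chord | true | false | true = inj₂ (inj₁
    (iso-from-Fin4 G G₂ σ (quadruple-injective (≢-sym v≢l₁) l₁≢l₂ l₁≢l₃ v≢l₂ v≢l₃ l₂≢l₃)
      (onto σ #1 #0 #2 #3 refl refl refl refl) (adj-table G G₂ σ (flip v~l₁) a₁₂ a₁₃ v~l₂ v~l₃ a₂₃)))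
    where σ = quadruple l₁ v l₂ l₃
  claw-with-chord⇒exceptional chord | false | true | true = inj₂ (inj₁
    (iso-from-Fin4 G G₂ σ (quadruple-injective (≢-sym v≢l₁) l₁≢l₃ l₁≢l₂ v≢l₃ v≢l₂ (≢-sym l₂≢l₃))
      (onto σ #1 #0 #3 #2 refl refl refl refl) (adj-table G G₂ σ (flip v~l₁) a₁₃ a₁₂ v~l₃ v~l₂ (flip a₂₃))))
    where σ = quadruple l₁ v l₃ l₂
  claw-with-chord⇒exceptional chord | true | true | true = inj₂ (inj₂
    (iso-from-Fin4 G G₃ σ (quadruple-injective v≢l₁ v≢l₂ v≢l₃ l₁≢l₂ l₁≢l₃ l₂≢l₃)
      (onto σ #0 #1 #2 #3 refl refl refl refl) (adj-table G G₃ σ v~l₁ v~l₂ v~l₃ a₁₂ a₁₃ a₂₃)))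
    where σ = quadruple v l₁ l₂ l₃

-- Automorphisms of L(G) mapping a claw onto a triangle

module ClawImage {n : ℕ} (G : SimpleGraph n) (conn : Connected G) (ψ : Aut (L G)) where
  open Edges G
  open Triangles G

  P : Edge G → Edge G
  P = to (proj₁ ψ)

  P-~ : ∀ {g h} → g ~ h → P g ~ P h
  P-~ {g} {h} = ⇔-from (proj₂ ψ g h)

  P-~⁻ : ∀ {g h} → P g ~ P h → g ~ h
  P-~⁻ {g} {h} = ⇔-to (proj₂ ψ g h)

  -- If P maps the claw e₁ e₂ e₃ at v onto a triangle, a fourth edge at v would be adjacent to all
  -- three sides, and an edge at a leaf missing v and the other leaves to exactly one side. So v and
  -- its three neighbours are all of G, and a side P eᵢ missing v is an edge between two leaves.
  private
    module Claw {v : Fin n} (e₁ e₂ e₃ : Edge G) (e₁≢e₂ : e₁ ≢ e₂) (e₁≢e₃ : e₁ ≢ e₃) (e₂≢e₃ : e₂ ≢ e₃)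
                (v∈e₁ : v ∈ₑ e₁) (v∈e₂ : v ∈ₑ e₂) (v∈e₃ : v ∈ₑ e₃)
                (no-common : ¬ CommonEnd (P e₁) (P e₂) (P e₃)) where
      open OtherEnd

      triangle : Triangle (P e₁) (P e₂) (P e₃)
      triangle = P-~ (e₁≢e₂ , v , v∈e₁ , v∈e₂) , P-~ (e₁≢e₃ , v , v∈e₁ , v∈e₃) , P-~ (e₂≢e₃ , v , v∈e₂ , v∈e₃)
               , no-common

      o₁ = other-end e₁ v∈e₁
      o₂ = other-end e₂ v∈e₂
      o₃ = other-end e₃ v∈e₃

      edges-at-v : ∀ g → v ∈ₑ g → g ≡ e₁ ⊎ g ≡ e₂ ⊎ g ≡ e₃
      edges-at-v g v∈g with g ≟ₑ e₁ | g ≟ₑ e₂ | g ≟ₑ e₃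
      ... | yes p | _ | _ = inj₁ p
      ... | no _ | yes p | _ = inj₂ (inj₁ p)
      ... | no _ | no _ | yes p = inj₂ (inj₂ p)
      ... | no g≢e₁ | no g≢e₂ | no g≢e₃ = ⊥-elim (triangle-¬three-neighbours triangle
              (P-~ (g≢e₁ , v , v∈g , v∈e₁)) (P-~ (g≢e₂ , v , v∈g , v∈e₂)) (P-~ (g≢e₃ , v , v∈g , v∈e₃)))

      edges-at-l₁ : ∀ g → end o₁ ∈ₑ g → v ∈ₑ g ⊎ end o₂ ∈ₑ g ⊎ end o₃ ∈ₑ g
      edges-at-l₁ g l₁∈g with v ∈ₑ? g | end o₂ ∈ₑ? g | end o₃ ∈ₑ? g
      ... | yes p | _ | _ = inj₁ p
      ... | no _ | yes p | _ = inj₂ (inj₁ p)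
      ... | no _ | no _ | yes p = inj₂ (inj₂ p)
      ... | no v∉g | no l₂∉g | no l₃∉g =
        ⊥-elim (triangle-¬one-neighbour triangle (P-~ g~e₁) (λ r → g≁ o₂ l₂∉g (P-~⁻ r)) (λ r → g≁ o₃ l₃∉g (P-~⁻ r)))
        where
          g~e₁ : g ~ e₁
          g~e₁ = (λ { refl → v∉g v∈e₁ }) , end o₁ , l₁∈g , end∈e o₁
          g≁ : ∀ {e} (o : OtherEnd v e) → ¬ end o ∈ₑ g → ¬ g ~ e
          g≁ o l∉g (_ , x , x∈g , x∈e) with v-or-end o x x∈e
          ... | inj₁ refl = v∉g x∈g
          ... | inj₂ refl = l∉g x∈g

    module ClawCover {v : Fin n} (e₁ e₂ e₃ : Edge G) (e₁≢e₂ : e₁ ≢ e₂) (e₁≢e₃ : e₁ ≢ e₃) (e₂≢e₃ : e₂ ≢ e₃)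
                     (v∈e₁ : v ∈ₑ e₁) (v∈e₂ : v ∈ₑ e₂) (v∈e₃ : v ∈ₑ e₃)
                     (no-common : ¬ CommonEnd (P e₁) (P e₂) (P e₃)) where
      module C₁ = Claw e₁ e₂ e₃ e₁≢e₂ e₁≢e₃ e₂≢e₃ v∈e₁ v∈e₂ v∈e₃ no-common
      module C₂ = Claw e₂ e₁ e₃ (≢-sym e₁≢e₂) e₂≢e₃ e₁≢e₃ v∈e₂ v∈e₁ v∈e₃
                    (λ (w , w∈₁ , w∈₂ , w∈₃) → no-common (w , w∈₂ , w∈₁ , w∈₃))
      module C₃ = Claw e₃ e₂ e₁ (≢-sym e₂≢e₃) (≢-sym e₁≢e₃) (≢-sym e₁≢e₂) v∈e₃ v∈e₂ v∈e₁
                    (λ (w , w∈₁ , w∈₂ , w∈₃) → no-common (w , w∈₃ , w∈₂ , w∈₁))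
      open OtherEnd
      open C₁ public using (o₁; o₂; o₃; edges-at-v)

      l₁ = end o₁
      l₂ = end o₂
      l₃ = end o₃

      leaves-distinct : ∀ {e e′} (o : OtherEnd v e) (o′ : OtherEnd v e′) → e ≢ e′ → v ∈ₑ e → v ∈ₑ e′ →
                        end o ≢ end o′
      leaves-distinct {e} {e′} o o′ e≢e′ v∈e v∈e′ l≡l′ =
        e≢e′ (ends⇒≡ e e′ (≢-sym (end≢v o)) v∈e (end∈e o) v∈e′ (subst (_∈ₑ e′) (≡-sym l≡l′) (end∈e o′)))

      l₁≢l₂ = leaves-distinct o₁ o₂ e₁≢e₂ v∈e₁ v∈e₂
      l₁≢l₃ = leaves-distinct o₁ o₃ e₁≢e₃ v∈e₁ v∈e₃
      l₂≢l₃ = leaves-distinct o₂ o₃ e₂≢e₃ v∈e₂ v∈e₃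

      InClaw : Fin n → Set
      InClaw x = x ≡ v ⊎ x ≡ l₁ ⊎ x ≡ l₂ ⊎ x ≡ l₃

      neighbour-among : ∀ {l y x₁ x₂ x₃} → Adj G l y → (∀ g → l ∈ₑ g → x₁ ∈ₑ g ⊎ x₂ ∈ₑ g ⊎ x₃ ∈ₑ g) →
                        l ≢ x₁ → l ≢ x₂ → l ≢ x₃ → y ≡ x₁ ⊎ y ≡ x₂ ⊎ y ≡ x₃
      neighbour-among {l} {y} ly edges-at-l l≢x₁ l≢x₂ l≢x₃ with edge-of ly
      ... | g , l∈g , y∈g = Sum.map (is-y l≢x₁) (Sum.map (is-y l≢x₂) (is-y l≢x₃)) (edges-at-l g l∈g)
        where
          is-y : ∀ {x} → l ≢ x → x ∈ₑ g → y ≡ x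
          is-y l≢x x∈g with ends-unique g (adj⇒≢ ly) l∈g y∈g x∈g
          ... | inj₁ x≡l = ⊥-elim (l≢x (≡-sym x≡l))
          ... | inj₂ x≡y = ≡-sym x≡y

      neighbour-is-end : ∀ {y e} (o : OtherEnd v e) → Adj G v y → y ∈ₑ e → y ≡ end o
      neighbour-is-end {y} o vy y∈e = [ (λ y≡v → ⊥-elim (adj⇒≢ vy (≡-sym y≡v))) , id ]′ (v-or-end o y y∈e)

      neighbour-of-v : ∀ {y} → Adj G v y → InClaw y
      neighbour-of-v {y} vy with edge-of vy
      ... | g , v∈g , y∈g with edges-at-v g v∈g
      ...   | inj₁ refl = inj₂ (inj₁ (neighbour-is-end o₁ vy y∈g))
      ...   | inj₂ (inj₁ refl) = inj₂ (inj₂ (inj₁ (neighbour-is-end o₂ vy y∈g)))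
      ...   | inj₂ (inj₂ refl) = inj₂ (inj₂ (inj₂ (neighbour-is-end o₃ vy y∈g)))

      neighbour-in-claw : ∀ {w y} → InClaw w → Adj G w y → InClaw y
      neighbour-in-claw (inj₁ refl) wy = neighbour-of-v wy
      neighbour-in-claw (inj₂ (inj₁ refl)) wy =
        [ inj₁ , [ inj₂ ∘ inj₂ ∘ inj₁ , inj₂ ∘ inj₂ ∘ inj₂ ]′ ]′
          (neighbour-among wy C₁.edges-at-l₁ (end≢v o₁) l₁≢l₂ l₁≢l₃)
      neighbour-in-claw (inj₂ (inj₂ (inj₁ refl))) wy =
        [ inj₁ , [ inj₂ ∘ inj₁ , inj₂ ∘ inj₂ ∘ inj₂ ]′ ]′
          (neighbour-among wy C₂.edges-at-l₁ (end≢v o₂) (≢-sym l₁≢l₂) l₂≢l₃)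
      neighbour-in-claw (inj₂ (inj₂ (inj₂ refl))) wy =
        [ inj₁ , [ inj₂ ∘ inj₂ ∘ inj₁ , inj₂ ∘ inj₁ ]′ ]′
          (neighbour-among wy C₃.edges-at-l₁ (end≢v o₃) (≢-sym l₂≢l₃) (≢-sym l₁≢l₃))

      reachable-in-claw : ∀ {w x} → InClaw w → Reach G w x → InClaw x
      reachable-in-claw w∈ here = w∈
      reachable-in-claw w∈ (step wy y⇝x) = reachable-in-claw (neighbour-in-claw w∈ wy) y⇝x

      covers : ∀ x → InClaw x
      covers x = reachable-in-claw (inj₁ refl) (conn v x)

      Chord = Adj G l₁ l₂ ⊎ Adj G l₁ l₃ ⊎ Adj G l₂ l₃

      chord-between-leaves : ∀ {x y} → InClaw x → InClaw y → x ≢ v → y ≢ v → x ≢ y → Adj G x y → Chord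
      chord-between-leaves (inj₁ refl) _ x≢v _ _ _ = ⊥-elim (x≢v refl)
      chord-between-leaves _ (inj₁ refl) _ y≢v _ _ = ⊥-elim (y≢v refl)
      chord-between-leaves (inj₂ (inj₁ refl)) (inj₂ (inj₁ refl)) _ _ x≢y _ = ⊥-elim (x≢y refl)
      chord-between-leaves (inj₂ (inj₂ (inj₁ refl))) (inj₂ (inj₂ (inj₁ refl))) _ _ x≢y _ = ⊥-elim (x≢y refl)
      chord-between-leaves (inj₂ (inj₂ (inj₂ refl))) (inj₂ (inj₂ (inj₂ refl))) _ _ x≢y _ = ⊥-elim (x≢y refl)
      chord-between-leaves (inj₂ (inj₁ refl)) (inj₂ (inj₂ (inj₁ refl))) _ _ _ xy = inj₁ xy
      chord-between-leaves (inj₂ (inj₁ refl)) (inj₂ (inj₂ (inj₂ refl))) _ _ _ xy = inj₂ (inj₁ xy)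
      chord-between-leaves (inj₂ (inj₂ (inj₁ refl))) (inj₂ (inj₂ (inj₂ refl))) _ _ _ xy = inj₂ (inj₂ xy)
      chord-between-leaves (inj₂ (inj₂ (inj₁ refl))) (inj₂ (inj₁ refl)) _ _ _ xy = inj₁ (adj-sym xy)
      chord-between-leaves (inj₂ (inj₂ (inj₂ refl))) (inj₂ (inj₁ refl)) _ _ _ xy = inj₂ (inj₁ (adj-sym xy))
      chord-between-leaves (inj₂ (inj₂ (inj₂ refl))) (inj₂ (inj₂ (inj₁ refl))) _ _ _ xy = inj₂ (inj₂ (adj-sym xy))

      edge-off-v : ∀ f → ¬ v ∈ₑ f → Chord
      edge-off-v f v∉f = chord-between-leaves (covers (lo f)) (covers (hi f))
        (λ eq → v∉f (inj₁ (≡-sym eq))) (λ eq → v∉f (inj₂ (≡-sym eq))) (lo≢hi f) (edge-adj f)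

      chord : Chord
      chord with v ∈ₑ? P e₁ | v ∈ₑ? P e₂ | v ∈ₑ? P e₃
      ... | no v∉ | _ | _ = edge-off-v (P e₁) v∉
      ... | yes _ | no v∉ | _ = edge-off-v (P e₂) v∉
      ... | yes _ | yes _ | no v∉ = edge-off-v (P e₃) v∉
      ... | yes v∈₁ | yes v∈₂ | yes v∈₃ = ⊥-elim (no-common (v , v∈₁ , v∈₂ , v∈₃))

  claw↦triangle⇒exceptional : ∀ {v} (e₁ e₂ e₃ : Edge G) → e₁ ≢ e₂ → e₁ ≢ e₃ → e₂ ≢ e₃ →
    v ∈ₑ e₁ → v ∈ₑ e₂ → v ∈ₑ e₃ → ¬ CommonEnd (P e₁) (P e₂) (P e₃) → Exceptional G
  claw↦triangle⇒exceptional {v} e₁ e₂ e₃ e₁≢e₂ e₁≢e₃ e₂≢e₃ v∈e₁ v∈e₂ v∈e₃ no-common =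
    claw-with-chord⇒exceptional G v l₁ l₂ l₃ (≢-sym (end≢v o₁)) (≢-sym (end≢v o₂)) (≢-sym (end≢v o₃))
      l₁≢l₂ l₁≢l₃ l₂≢l₃ covers (leaf-adj e₁ v∈e₁ o₁) (leaf-adj e₂ v∈e₂ o₂) (leaf-adj e₃ v∈e₃ o₃) chord
    where
      open ClawCover e₁ e₂ e₃ e₁≢e₂ e₁≢e₃ e₂≢e₃ v∈e₁ v∈e₂ v∈e₃ no-common
      open OtherEnd
      leaf-adj : ∀ e → v ∈ₑ e → (o : OtherEnd v e) → Adj G v (end o)
      leaf-adj e v∈e o = ends⇒adj e (≢-sym (end≢v o)) v∈e (end∈e o)

-- det(L(G)) ≤ det′(G) away from the exceptional graphs

module _ {n : ℕ} (G : SimpleGraph n) (conn : Connected G) (n≥3 : n ≥ 3) (¬exceptional : ¬ Exceptional G) where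
  open Edges G
  open ConnectedGraph G conn n≥3
  open Triangles G
  open Stabiliser G

  StarsMatch : (Edge G → Edge G) → (Edge G → Edge G) → Fin n → Fin n → Set
  StarsMatch P Q v w = (∀ e → v ∈ₑ e → w ∈ₑ P e) × (∀ f → w ∈ₑ f → v ∈ₑ Q f)

  star-centre-unique : ∀ {P Q} → (∀ f → P (Q f) ≡ f) →
                       ∀ {v w w′} → StarsMatch P Q v w → StarsMatch P Q v w′ → w ≡ w′
  star-centre-unique {P} {Q} P∘Q {w = w} {w′} (P-w , Q-w) (P-w′ , Q-w′) = same-star⇒≡
    (λ f w∈f → subst (w′ ∈ₑ_) (P∘Q f) (P-w′ (Q f) (Q-w f w∈f)))
    (λ f w′∈f → subst (w ∈ₑ_) (P∘Q f) (P-w (Q f) (Q-w′ f w′∈f)))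

  module StarImage (ψ : Aut (L G)) where
    open ClawImage G conn ψ public using (P)
    open ClawImage G conn ψ using (P-~; P-~⁻; claw↦triangle⇒exceptional)
    module ψ⁻¹ = ClawImage G conn (≅-sym {Γ = L G} {Δ = L G} ψ)

    Q : Edge G → Edge G
    Q = from (proj₁ ψ)

    P∘Q : ∀ f → P (Q f) ≡ f
    P∘Q = strictlyInverseˡ (proj₁ ψ)

    Q∘P : ∀ e → Q (P e) ≡ e
    Q∘P = strictlyInverseʳ (proj₁ ψ)

    -- Were some third edge at v not to meet the common end of P e₁ and P e₂,
    -- the claw formed with e₁ and e₂ would be mapped onto a triangle.
    star-image-of-branching : ∀ {v y y′} → Adj G v y → Adj G v y′ → y′ ≢ y → Σ[ w ∈ Fin n ] StarsMatch P Q v w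
    star-image-of-branching {v} {y} {y′} vy vy′ y′≢y with edge-of vy | edge-of vy′
    ... | e₁ , v∈e₁ , y∈e₁ | e₂ , v∈e₂ , y′∈e₂ = w , P-star , Q-star
      where
        e₁≢e₂ : e₁ ≢ e₂
        e₁≢e₂ refl = [ (λ y′≡v → adj⇒≢ vy′ (≡-sym y′≡v)) , y′≢y ]′ (ends-unique e₁ (adj⇒≢ vy) v∈e₁ y∈e₁ y′∈e₂)
        Pe₁~Pe₂ : P e₁ ~ P e₂
        Pe₁~Pe₂ = P-~ (e₁≢e₂ , v , v∈e₁ , v∈e₂)
        w = proj₁ (proj₂ Pe₁~Pe₂)
        w∈Pe₁ = proj₁ (proj₂ (proj₂ Pe₁~Pe₂))
        w∈Pe₂ = proj₂ (proj₂ (proj₂ Pe₁~Pe₂))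
        P-star : ∀ e → v ∈ₑ e → w ∈ₑ P e
        P-star e v∈e with e₁ ≟ₑ e | e₂ ≟ₑ e
        ... | yes refl | _ = w∈Pe₁
        ... | no _ | yes refl = w∈Pe₂
        ... | no e₁≢e | no e₂≢e with w ∈ₑ? P e
        ...   | yes w∈Pe = w∈Pe
        ...   | no w∉Pe = ⊥-elim (¬exceptional (claw↦triangle⇒exceptional e₁ e₂ e e₁≢e₂ e₁≢e e₂≢e v∈e₁ v∈e₂ v∈e
                  λ (c , c∈₁ , c∈₂ , c∈e) → w∉Pe (subst (_∈ₑ P e)
                    (common-end-unique (proj₁ Pe₁~Pe₂) w∈Pe₁ w∈Pe₂ c∈₁ c∈₂) c∈e)))
        Q-star : ∀ f → w ∈ₑ f → v ∈ₑ Q f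
        Q-star f w∈f with P e₁ ≟ₑ f | P e₂ ≟ₑ f
        ... | yes refl | _ = subst (v ∈ₑ_) (≡-sym (Q∘P e₁)) v∈e₁
        ... | no _ | yes refl = subst (v ∈ₑ_) (≡-sym (Q∘P e₂)) v∈e₂
        ... | no Pe₁≢f | no Pe₂≢f with v ∈ₑ? Q f
        ...   | yes v∈Qf = v∈Qf
        ...   | no v∉Qf = ⊥-elim (¬exceptional (ψ⁻¹.claw↦triangle⇒exceptional (P e₁) (P e₂) f
                  (proj₁ Pe₁~Pe₂) Pe₁≢f Pe₂≢f w∈Pe₁ w∈Pe₂ w∈f
                  λ (c , c∈₁ , c∈₂ , c∈Qf) → v∉Qf (subst (_∈ₑ Q f)
                    (common-end-unique e₁≢e₂ v∈e₁ v∈e₂ (subst (c ∈ₑ_) (Q∘P e₁) c∈₁) (subst (c ∈ₑ_) (Q∘P e₂) c∈₂))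
                    c∈Qf)))

    -- At a pendant vertex v with neighbour y, the image of the edge vy has the image x of y
    -- as one end; its other end is the image of v.
    star-image : ∀ v → Σ[ w ∈ Fin n ] StarsMatch P Q v w
    star-image v with local-shape v
    ... | branching vy vy′ y′≢y = star-image-of-branching vy vy′ y′≢y
    ... | pendant {y} vy only-y yy′ y′≢v = w , P-star , Q-star
      where
        open OtherEnd
        y-image = star-image-of-branching (adj-sym vy) yy′ y′≢v
        x = proj₁ y-image
        P-star-y = proj₁ (proj₂ y-image)
        e = proj₁ (edge-of vy)
        v∈e = proj₁ (proj₂ (edge-of vy))
        y∈e = proj₂ (proj₂ (edge-of vy))
        x∈Pe : x ∈ₑ P e
        x∈Pe = P-star-y e y∈e
        o = other-end (P e) x∈Pe
        w = end o
        P-star : ∀ e′ → v ∈ₑ e′ → w ∈ₑ P e′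
        P-star e′ v∈e′ = subst (λ g → w ∈ₑ P g) (ends⇒≡ e e′ (adj⇒≢ vy) v∈e y∈e v∈e′ y∈e′) (end∈e o)
          where
            o′ = other-end e′ v∈e′
            y∈e′ : y ∈ₑ e′
            y∈e′ = subst (_∈ₑ e′) (only-y (end o′) (ends⇒adj e′ (≢-sym (end≢v o′)) v∈e′ (end∈e o′))) (end∈e o′)
        Q-star : ∀ f → w ∈ₑ f → v ∈ₑ Q f
        Q-star f w∈f with f ≟ₑ P e
        ... | yes refl = subst (v ∈ₑ_) (≡-sym (Q∘P e)) v∈e
        ... | no f≢Pe with P-~⁻ {Q f} {e} (subst (_~ P e) (≡-sym (P∘Q f)) (f≢Pe , w , w∈f , end∈e o))
        ...   | _ , c , c∈Qf , c∈e with ends-unique e (adj⇒≢ vy) v∈e y∈e c∈e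
        ...     | inj₁ refl = c∈Qf
        ...     | inj₂ refl = ⊥-elim (f≢Pe (ends⇒≡ f (P e) (≢-sym (end≢v o))
                                 (subst (x ∈ₑ_) (P∘Q f) (P-star-y (Q f) c∈Qf)) w∈f x∈Pe (end∈e o)))

  module InducedAutomorphism (ψ : Aut (L G)) where
    private
      module ψ = StarImage ψ
      module ψ⁻¹ = StarImage (≅-sym {Γ = L G} {Δ = L G} ψ)

    φ φ⁻¹ : Fin n → Fin n
    φ v = proj₁ (ψ.star-image v)
    φ⁻¹ w = proj₁ (ψ⁻¹.star-image w)

    φ-star : ∀ {v} e → v ∈ₑ e → φ v ∈ₑ ψ.P e
    φ-star {v} = proj₁ (proj₂ (ψ.star-image v))

    private
      φ⁻¹∘φ : ∀ v → φ⁻¹ (φ v) ≡ v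
      φ⁻¹∘φ v = star-centre-unique {ψ⁻¹.P} {ψ⁻¹.Q} ψ⁻¹.P∘Q
                  (proj₂ (ψ⁻¹.star-image (φ v))) (Product.swap (proj₂ (ψ.star-image v)))

      φ∘φ⁻¹ : ∀ w → φ (φ⁻¹ w) ≡ w
      φ∘φ⁻¹ w = star-centre-unique {ψ.P} {ψ.Q} ψ.P∘Q
                  (proj₂ (ψ.star-image (φ⁻¹ w))) (Product.swap (proj₂ (ψ⁻¹.star-image w)))

      φ⁻¹-star : ∀ {w} f → w ∈ₑ f → φ⁻¹ w ∈ₑ ψ⁻¹.P f
      φ⁻¹-star {w} = proj₁ (proj₂ (ψ⁻¹.star-image w))

      preserves-adj : ∀ {u v} (ρ : Fin n → Fin n) (P : Edge G → Edge G) → (∀ {x} e → x ∈ₑ e → ρ x ∈ₑ P e) →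
                      (∀ {x y} → ρ x ≡ ρ y → x ≡ y) → Adj G u v → Adj G (ρ u) (ρ v)
      preserves-adj ρ P ρ-star ρ-injective uv with edge-of uv
      ... | e , u∈e , v∈e = ends⇒adj (P e) (λ eq → adj⇒≢ uv (ρ-injective eq)) (ρ-star e u∈e) (ρ-star e v∈e)

      left-inverse⇒injective : ∀ {ρ ρ⁻¹ : Fin n → Fin n} → (∀ x → ρ⁻¹ (ρ x) ≡ x) → ∀ {x y} → ρ x ≡ ρ y → x ≡ y
      left-inverse⇒injective {ρ⁻¹ = ρ⁻¹} left-inverse {x} {y} eq =
        trans (≡-sym (left-inverse x)) (trans (cong ρ⁻¹ eq) (left-inverse y))

    induced : Aut (toGraph G)
    induced = mk↔ₛ′ φ φ⁻¹ φ∘φ⁻¹ φ⁻¹∘φ , λ u v → mk⇔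
      (λ φu~φv → subst₂ (Adj G) (φ⁻¹∘φ u) (φ⁻¹∘φ v)
                   (preserves-adj φ⁻¹ ψ⁻¹.P φ⁻¹-star (left-inverse⇒injective {φ⁻¹} {φ} φ∘φ⁻¹) φu~φv))
      (preserves-adj φ ψ.P φ-star (left-inverse⇒injective {φ} {φ⁻¹} φ⁻¹∘φ))

  edgeDet⇒vertexDet : ∀ T → EdgeDetSet G T → VertexDetSet (L G) T
  edgeDet⇒vertexDet T T-det ψ ψ-fixes-T e = ≡-sym (ends⇒≡ e (to (proj₁ ψ) e) (lo≢hi e) (inj₁ refl) (inj₂ refl)
      (subst (_∈ₑ to (proj₁ ψ) e) (φ-identity (lo e)) (φ-star e (inj₁ refl)))
      (subst (_∈ₑ to (proj₁ ψ) e) (φ-identity (hi e)) (φ-star e (inj₂ refl))))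
    where
      open InducedAutomorphism ψ
      φ-identity : ∀ v → φ v ≡ v
      φ-identity = T-det induced λ e e∈T → stabilises⇒fixesEnds (proj₁ induced) e
        λ v v∈e → subst (φ v ∈ₑ_) (ψ-fixes-T e e∈T) (φ-star e v∈e)

  det≤edgeDet : ∀ a b → EdgeDetIs G a → DetIs (L G) b → b ℕ.≤ a
  det≤edgeDet a b ((T , T-unique , |T|≡a , T-det) , _) (_ , b-min) =
    subst (b ℕ.≤_) |T|≡a (b-min T T-unique (edgeDet⇒vertexDet T T-det))

module _ {n m : ℕ} (G : SimpleGraph n) (X : SimpleGraph m) (G≅X : Iso G X) where
  private
    F = Iso⇒≅ {G = G} {H = X} G≅X
    F⁻¹ = ≅-sym {Γ = toGraph G} {Δ = toGraph X} F
    LF = lineGraph-≅ G X F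
    χ = to (proj₁ LF)
    χ⁻¹ = from (proj₁ LF)
    χ∘χ⁻¹ = strictlyInverseˡ (proj₁ LF)
    χ⁻¹∘χ = strictlyInverseʳ (proj₁ LF)
    module G = Edges G
    module X = Edges X
    module GS = Stabiliser G
    module XS = Stabiliser X

  edgeDet-transport : ∀ T′ → EdgeDetSet X T′ → EdgeDetSet G (map χ⁻¹ T′)
  edgeDet-transport T′ T′-det φ φ-fixes-T y =
    ↔-injective (proj₁ F) (trans (cong (λ z → to (proj₁ F) (to (proj₁ φ) z)) (≡-sym (strictlyInverseʳ (proj₁ F) y)))
                                 (φX-identity (to (proj₁ F) y)))
    where
      φX : Aut (toGraph X)
      φX = conjugate {Γ = toGraph X} {Δ = toGraph G} F⁻¹ φ
      stabilises : ∀ e′ → e′ ∈ T′ → XS.Stabilises (proj₁ φX) e′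
      stabilises e′ e′∈T′ x x∈e′ = subst (_ X.∈ₑ_) (χ∘χ⁻¹ e′)
        (EdgeMap.mapEdge-∈ G X F (χ⁻¹ e′)
          (GS.fixesEnds⇒stabilises (proj₁ φ) (χ⁻¹ e′) (φ-fixes-T (χ⁻¹ e′) (∈-map⁺ χ⁻¹ e′∈T′)) (from (proj₁ F) x)
            (EdgeMap.mapEdge-∈ X G F⁻¹ e′ x∈e′)))
      φX-identity : ∀ x → to (proj₁ F) (to (proj₁ φ) (from (proj₁ F) x)) ≡ x
      φX-identity = T′-det φX (λ e′ e′∈T′ → XS.stabilises⇒fixesEnds (proj₁ φX) e′ (stabilises e′ e′∈T′))

  vertexDet-transport : ∀ S → VertexDetSet (L G) S → VertexDetSet (L X) (map χ S)
  vertexDet-transport S S-det ψ′ ψ′-fixes e′ =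
    trans (cong (to (proj₁ ψ′)) (≡-sym (χ∘χ⁻¹ e′)))
      (trans (≡-sym (χ∘χ⁻¹ _)) (trans (cong χ (ψ-identity (χ⁻¹ e′))) (χ∘χ⁻¹ e′)))
    where
      ψ : Aut (L G)
      ψ = conjugate {Γ = L G} {Δ = L X} LF ψ′
      ψ-identity : ∀ e → χ⁻¹ (to (proj₁ ψ′) (χ e)) ≡ e
      ψ-identity = S-det ψ (λ e e∈S → trans (cong χ⁻¹ (ψ′-fixes (χ e) (∈-map⁺ χ e∈S))) (χ⁻¹∘χ e))

  edgeDet-≤-via-iso : ∀ a T′ → EdgeDetIs G a → Unique T′ → EdgeDetSet X T′ → a ℕ.≤ length T′
  edgeDet-≤-via-iso a T′ (_ , a-min) T′-unique T′-det = subst (a ℕ.≤_) (length-map χ⁻¹ T′)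
    (a-min (map χ⁻¹ T′) (Unique.map⁺ (↔-injective (↔-sym (proj₁ LF))) T′-unique) (edgeDet-transport T′ T′-det))

  det->-via-iso : ∀ b k → DetIs (L G) b → (∀ S′ → VertexDetSet (L X) S′ → k ℕ.< length S′) → k ℕ.< b
  det->-via-iso b k ((S , _ , |S|≡b , S-det) , _) bound =
    subst (k ℕ.<_) (trans (length-map χ S) |S|≡b) (bound (map χ S) (vertexDet-transport S S-det))

-- Twin edges force vertex determining sets of L(X) to be large

covering-length : ∀ {k} (xs : List (Fin k)) → (∀ c → c ∈ xs) → k ℕ.≤ length xs
covering-length {k} xs covers with k ℕ.≤? length xs
... | yes k≤|xs| = k≤|xs|
... | no k≰|xs| with Fin.pigeonhole (ℕ.≰⇒> k≰|xs|) (λ c → Any.index (covers c))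
...   | i , j , i<j , same-index =
  ⊥-elim (Fin.<-irrefl i≡j i<j)
  where
    i≡j = trans (lookup-index (covers i)) (trans (cong (lookup xs) same-index) (≡-sym (lookup-index (covers j))))

module TwinEdges {m : ℕ} (X : SimpleGraph m) where
  open Edges X

  Twins : Edge X → Edge X → Set
  Twins a b = ∀ g → g ≢ a → g ≢ b → (g ~ a ⇔ g ~ b)

  module Swap {a b : Edge X} (a≢b : a ≢ b) (twins : Twins a b) where

    data Position (x : Edge X) : Set where
      is-a  : x ≡ a → Position x
      is-b  : x ≡ b → Position x
      other : x ≢ a → x ≢ b → Position x

    position : ∀ x → Position x
    position x with x ≟ₑ a | x ≟ₑ b
    ... | yes x≡a | _       = is-a x≡a
    ... | no _    | yes x≡b = is-b x≡b
    ... | no x≢a  | no x≢b  = other x≢a x≢b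

    swap′ : ∀ {x} → Position x → Edge X
    swap′ (is-a _) = b
    swap′ (is-b _) = a
    swap′ {x} (other _ _) = x

    swap : Edge X → Edge X
    swap x = swap′ (position x)

    swap-a : swap a ≡ b
    swap-a with position a
    ... | is-a _ = refl
    ... | is-b a≡b = ⊥-elim (a≢b a≡b)
    ... | other a≢a _ = ⊥-elim (a≢a refl)

    swap-b : swap b ≡ a
    swap-b with position b
    ... | is-a b≡a = ⊥-elim (a≢b (≡-sym b≡a))
    ... | is-b _ = refl
    ... | other _ b≢b = ⊥-elim (b≢b refl)

    swap-other : ∀ {x} → x ≢ a → x ≢ b → swap x ≡ x
    swap-other {x} x≢a x≢b with position x
    ... | is-a x≡a = ⊥-elim (x≢a x≡a)
    ... | is-b x≡b = ⊥-elim (x≢b x≡b)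
    ... | other _ _ = refl

    swap-involutive : ∀ x → swap (swap x) ≡ x
    swap-involutive x with position x
    ... | is-a refl = swap-b
    ... | is-b refl = swap-a
    ... | other x≢a x≢b = swap-other x≢a x≢b

    swap-~′ : ∀ {u v} (pu : Position u) (pv : Position v) → swap′ pu ~ swap′ pv ⇔ u ~ v
    swap-~′ (is-a refl) (is-a refl) = mk⇔ (⊥-elim ∘ ~-irrefl) (⊥-elim ∘ ~-irrefl)
    swap-~′ (is-a refl) (is-b refl) = ~-comm
    swap-~′ (is-a refl) (other v≢a v≢b) = ⇔-trans ~-comm (⇔-trans (⇔-sym (twins _ v≢a v≢b)) ~-comm)
    swap-~′ (is-b refl) (is-a refl) = ~-comm
    swap-~′ (is-b refl) (is-b refl) = mk⇔ (⊥-elim ∘ ~-irrefl) (⊥-elim ∘ ~-irrefl)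
    swap-~′ (is-b refl) (other v≢a v≢b) = ⇔-trans ~-comm (⇔-trans (twins _ v≢a v≢b) ~-comm)
    swap-~′ (other u≢a u≢b) (is-a refl) = ⇔-sym (twins _ u≢a u≢b)
    swap-~′ (other u≢a u≢b) (is-b refl) = twins _ u≢a u≢b
    swap-~′ (other _ _) (other _ _) = ⇔-id _

    swap-automorphism : Aut (L X)
    swap-automorphism = mk↔ₛ′ swap swap swap-involutive swap-involutive , λ u v → swap-~′ (position u) (position v)

  avoided-twins⇒¬vertexDet : ∀ {a b} → a ≢ b → Twins a b → ∀ S → (∀ x → x ∈ S → x ≢ a × x ≢ b) →
                             ¬ VertexDetSet (L X) S
  avoided-twins⇒¬vertexDet a≢b twins S avoids S-det =
    a≢b (trans (≡-sym (S-det swap-automorphism fixes-S _)) swap-a)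
    where
      open Swap a≢b twins
      fixes-S : ∀ x → x ∈ S → swap x ≡ x
      fixes-S x x∈S = swap-other (proj₁ (avoids x x∈S)) (proj₂ (avoids x x∈S))

  twin-pairs⇒det-bound : ∀ {k} (a b : Fin k → Edge X) → (∀ c → a c ≢ b c) → (∀ c → Twins (a c) (b c)) →
                         (pair : Edge X → Fin k) → (∀ c → pair (a c) ≡ c) → (∀ c → pair (b c) ≡ c) →
                         ∀ S → VertexDetSet (L X) S → k ℕ.≤ length S
  twin-pairs⇒det-bound {k} a b a≢b twins pair pair-a pair-b S S-det =
    subst (k ℕ.≤_) (length-map pair S) (covering-length (map pair S) met)
    where
      open DecMembership (Fin._≟_ {k}) using (_∈?_)
      met : ∀ c → c ∈ map pair S
      met c with c ∈? map pair S
      ... | yes c∈ = c∈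
      ... | no c∉ = ⊥-elim (avoided-twins⇒¬vertexDet (a≢b c) (twins c) S avoids S-det)
        where
          avoids : ∀ x → x ∈ S → x ≢ a c × x ≢ b c
          avoids x x∈S = (λ { refl → c∉ (subst (_∈ map pair S) (pair-a c) (∈-map⁺ pair x∈S)) })
                       , (λ { refl → c∉ (subst (_∈ map pair S) (pair-b c) (∈-map⁺ pair x∈S)) })

  Meets : Fin m → Fin m → Edge X → Set
  Meets x y e = x ∈ₑ e ⊎ y ∈ₑ e

  TwinsAt : Edge X → Edge X → Fin m → Fin m → Set
  TwinsAt a b x y = x < y → Adj X x y → (x ≡ lo a × y ≡ hi a) ⊎ (x ≡ lo b × y ≡ hi b) ⊎
                    ((Meets x y a → Meets x y b) × (Meets x y b → Meets x y a))

  twinsAt? : ∀ a b x y → Dec (TwinsAt a b x y)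
  twinsAt? a b x y = x Fin.<? y →-dec adj? x y →-dec
    ((x Fin.≟ lo a ×-dec y Fin.≟ hi a) ⊎-dec (x Fin.≟ lo b ×-dec y Fin.≟ hi b) ⊎-dec
     ((meets? a →-dec meets? b) ×-dec (meets? b →-dec meets? a)))
    where meets? = λ e → x ∈ₑ? e ⊎-dec y ∈ₑ? e

  twinsAt⇒twins : ∀ {a b} → (∀ x y → TwinsAt a b x y) → Twins a b
  twinsAt⇒twins {a} {b} twins-at g@((x , y) , x<y , xy) g≢a g≢b with twins-at x y x<y xy
  ... | inj₁ (p , q) = ⊥-elim (g≢a (edge-≡ g a p q))
  ... | inj₂ (inj₁ (p , q)) = ⊥-elim (g≢b (edge-≡ g b p q))
  ... | inj₂ (inj₂ (a⇒b , b⇒a)) = mk⇔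
        (λ (_ , v , v∈g , v∈a) → g≢b , meet {e = b} (a⇒b (meets {e = a} v∈g v∈a)))
        (λ (_ , v , v∈g , v∈b) → g≢a , meet {e = a} (b⇒a (meets {e = b} v∈g v∈b)))
    where
      meets : ∀ {v e} → v ∈ₑ g → v ∈ₑ e → Meets x y e
      meets (inj₁ refl) v∈e = inj₁ v∈e
      meets (inj₂ refl) v∈e = inj₂ v∈e
      meet : ∀ {e} → Meets x y e → Σ[ v ∈ Fin m ] v ∈ₑ g × v ∈ₑ e
      meet (inj₁ x∈e) = x , inj₁ refl , x∈e
      meet (inj₂ y∈e) = y , inj₂ refl , y∈e

  twins-by-computation : ∀ a b → True (Fin.all? λ x → Fin.all? λ y → twinsAt? a b x y) → Twins a b
  twins-by-computation a b ok = twinsAt⇒twins (toWitness ok)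

-- The exceptional graphs

edge : ∀ {n} (X : SimpleGraph n) (x y : Fin n) {x<y : True (x Fin.<? y)} {xy : True (Edges.adj? X x y)} → Edge X
edge X x y {x<y} {xy} = (x , y) , toWitness x<y , toWitness xy

module Rigidity (X : SimpleGraph 4) where
  open Stabiliser X

  -- Adjacency is only required to be preserved, not reflected: on a finite graph an injective
  -- adjacency-preserving map is already an automorphism, so the enumeration still succeeds.
  Rigid : List (Edge X) → (Fin 4 → Fin 4) → Set
  Rigid T t = (∀ u v → t u ≡ t v → u ≡ v) → (∀ u v → Adj X u v → Adj X (t u) (t v)) →
              All (FixesEnds t) T → ∀ u → t u ≡ u

  rigid? : ∀ T t → Dec (Rigid T t)
  rigid? T t = (Fin.all? λ u → Fin.all? λ v → t u Fin.≟ t v →-dec u Fin.≟ v)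
         →-dec ((Fin.all? λ u → Fin.all? λ v → Edges.adj? X u v →-dec Edges.adj? X (t u) (t v))
         →-dec (All.all? (fixesEnds? t) T →-dec Fin.all? λ u → t u Fin.≟ u))

  edgeDet-by-enumeration : ∀ T → True (Fin.all? λ a → Fin.all? λ b → Fin.all? λ c → Fin.all? λ d →
                                         rigid? T (quadruple a b c d)) →
                           EdgeDetSet X T
  edgeDet-by-enumeration T ok φ φ-fixes-T v = trans (≡-sym (t≗φ v))
    (toWitness ok (φ′ #0) (φ′ #1) (φ′ #2) (φ′ #3)
      (λ u w eq → ↔-injective (proj₁ φ) (trans (≡-sym (t≗φ u)) (trans eq (t≗φ w))))
      (λ u w uw → subst₂ (Adj X) (≡-sym (t≗φ u)) (≡-sym (t≗φ w)) (⇔-from (proj₂ φ u w) uw))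
      (All.tabulate λ {e} e∈T → fixesEnds-cong (≡-sym ∘ t≗φ) e (φ-fixes-T e e∈T))
      v)
    where
      φ′ = to (proj₁ φ)
      t≗φ : quadruple (φ′ #0) (φ′ #1) (φ′ #2) (φ′ #3) ≗ φ′
      t≗φ #0 = refl
      t≗φ #1 = refl
      t≗φ #2 = refl
      t≗φ #3 = refl

record DetGap {m : ℕ} (X : SimpleGraph m) : Set where
  field
    T              : List (Edge X)
    T-unique       : Unique T
    T-edgeDet      : EdgeDetSet X T
    vertexDet-long : ∀ S → VertexDetSet (L X) S → length T ℕ.< length S

gap-via-iso : ∀ {n m} (G : SimpleGraph n) (X : SimpleGraph m) → Iso G X → DetGap X →
              ∀ a b → EdgeDetIs G a → DetIs (L G) b → a ℕ.< b
gap-via-iso G X G≅X gap a b det′≡a det≡b = ℕ.≤-<-trans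
  (edgeDet-≤-via-iso G X G≅X a T det′≡a T-unique T-edgeDet)
  (det->-via-iso G X G≅X b (length T) det≡b vertexDet-long)
  where open DetGap gap

-- `pair` only needs to be right on the twin pairs; the remaining edge of G₂ (#1 #2) lands in pair 0.
G₁-gap : DetGap G₁
G₁-gap = record
  { T = edge G₁ #1 #2 ∷ [] ; T-unique = [] ∷ [] ; T-edgeDet = Rigidity.edgeDet-by-enumeration G₁ _ _
  ; vertexDet-long = twin-pairs⇒det-bound a b (λ { #0 () ; #1 () }) twins pair
                       (λ { #0 → refl ; #1 → refl }) (λ { #0 → refl ; #1 → refl }) }
  where
    open TwinEdges G₁
    a b : Fin 2 → Edge G₁
    a #0 = edge G₁ #0 #1
    a #1 = edge G₁ #1 #2
    b #0 = edge G₁ #2 #3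
    b #1 = edge G₁ #1 #3
    twins : ∀ c → Twins (a c) (b c)
    twins #0 = twins-by-computation (a #0) (b #0) _
    twins #1 = twins-by-computation (a #1) (b #1) _
    pair : Edge G₁ → Fin 2
    pair ((#1 , #2) , _) = #1
    pair ((#1 , #3) , _) = #1
    pair _ = #0

G₂-gap : DetGap G₂
G₂-gap = record
  { T = edge G₂ #0 #1 ∷ [] ; T-unique = [] ∷ [] ; T-edgeDet = Rigidity.edgeDet-by-enumeration G₂ _ _
  ; vertexDet-long = twin-pairs⇒det-bound a b (λ { #0 () ; #1 () }) twins pair
                       (λ { #0 → refl ; #1 → refl }) (λ { #0 → refl ; #1 → refl }) }
  where
    open TwinEdges G₂
    a b : Fin 2 → Edge G₂
    a #0 = edge G₂ #0 #1
    a #1 = edge G₂ #0 #2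
    b #0 = edge G₂ #2 #3
    b #1 = edge G₂ #1 #3
    twins : ∀ c → Twins (a c) (b c)
    twins #0 = twins-by-computation (a #0) (b #0) _
    twins #1 = twins-by-computation (a #1) (b #1) _
    pair : Edge G₂ → Fin 2
    pair ((#0 , #2) , _) = #1
    pair ((#1 , #3) , _) = #1
    pair _ = #0

G₃-gap : DetGap G₃
G₃-gap = record
  { T = edge G₃ #0 #1 ∷ edge G₃ #0 #2 ∷ [] ; T-unique = ((λ ()) ∷ []) ∷ [] ∷ []
  ; T-edgeDet = Rigidity.edgeDet-by-enumeration G₃ _ _
  ; vertexDet-long = twin-pairs⇒det-bound a b (λ { #0 () ; #1 () ; #2 () }) twins pair
                  (λ { #0 → refl ; #1 → refl ; #2 → refl }) (λ { #0 → refl ; #1 → refl ; #2 → refl }) }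
  where
    open TwinEdges G₃
    a b : Fin 3 → Edge G₃
    a #0 = edge G₃ #0 #1
    a #1 = edge G₃ #0 #2
    a #2 = edge G₃ #0 #3
    b #0 = edge G₃ #2 #3
    b #1 = edge G₃ #1 #3
    b #2 = edge G₃ #1 #2
    twins : ∀ c → Twins (a c) (b c)
    twins #0 = twins-by-computation (a #0) (b #0) _
    twins #1 = twins-by-computation (a #1) (b #1) _
    twins #2 = twins-by-computation (a #2) (b #2) _
    pair : Edge G₃ → Fin 3
    pair ((#0 , #2) , _) = #1
    pair ((#1 , #3) , _) = #1
    pair ((#0 , #3) , _) = #2
    pair ((#1 , #2) , _) = #2
    pair _ = #0

exceptional⇒det′<det : ∀ {n} (G : SimpleGraph n) → Exceptional G →
                       ∀ a b → EdgeDetIs G a → DetIs (L G) b → a ℕ.< b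
exceptional⇒det′<det G (inj₁ G≅G₁)        = gap-via-iso G G₁ G≅G₁ G₁-gap
exceptional⇒det′<det G (inj₂ (inj₁ G≅G₂)) = gap-via-iso G G₂ G≅G₂ G₂-gap
exceptional⇒det′<det G (inj₂ (inj₂ G≅G₃)) = gap-via-iso G G₃ G≅G₃ G₃-gap

theorem1 : ∀ (n : ℕ) (G : SimpleGraph n) → Connected G → n ≥ 3 →
    ∀ (a b : ℕ) → EdgeDetIs G a → DetIs (L G) b →
    (a ≡ b ⇔ (¬ (Iso G G₁ ⊎ Iso G G₂ ⊎ Iso G G₃)))
theorem1 n G conn n≥3 a b det′≡a det≡b = mk⇔
  (λ a≡b exceptional → ℕ.<-irrefl a≡b (exceptional⇒det′<det G exceptional a b det′≡a det≡b))
  (λ ¬exceptional → ℕ.≤-antisym (edgeDet≤det G conn n≥3 a b det′≡a det≡b)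
                                (det≤edgeDet G conn n≥3 ¬exceptional a b det′≡a det≡b))
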